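{- Let $q$ be a prime power, $r\ge 2$, $\mathbb{F}=\mathbb{F}_{q^r}$, $\sigma$ a generator of $\mathbb{F}^\times$, $\tau=\sigma^{q-1}$, $A=\mathbb{F}^+$, $G=A\rtimes\langle\tau\rangle$ with $\tau$ acting by field multiplication, $l=(q^r-1)/(q-1)$, and $A_0,\dots,A_{l-1}$ an ordering of the maximal subgroups of $A$ such that $\bigcup_{i=0}^{l-1}(A\setminus A_i)\tau^i$ is inverse-closed. Let $X_0=\{1_G\}$, $X_1=A_0\setminus\{1_G\}$, $X_2=A\setminus A_0$, $X_3=\bigcup_{i=1}^{l-1}A_i\tau^i$, $X_4=\bigcup_{i=1}^{l-1}(A\setminus A_i)\tau^i$. Let $\mathcal{X}$ be the Cayley scheme on $G$ with basis relations $s_i=s(X_i)$, $i\in\{0,\dots,4\}$ (this is a Higmanian scheme and $s_0,\dots,s_4$ is a standard ordering), and let $n_i=|X_i|$ be the valency of $s_i$ and $c_{ij}^k$ the intersection numbers. Then: (1) $c_{33}^3=c_{33}^4$; (2) $\frac{1}{n_3}+\frac{1}{n_4}=\frac{1}{n_1}-\frac{1}{n_1+1}$; (3) $\frac{n_2}{n_1+1}-\frac{2n_3}{n_4}=1$ if and only if $q=3$; (4) $\frac{n_2}{n_1+1}-\frac{2n_4}{n_3}\neq 1$.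
   Context: For $X\subseteq G$, $s(X)=\{(g,xg):x\in X,\ g\in G\}$. For a partition $\{s_0,\dots,s_4\}$ of $G^2$ forming an association scheme, the intersection number $c_{ij}^k$ is $|\{z:(x,z)\in s_i,(z,y)\in s_j\}|$ for any $(x,y)\in s_k$ (here all $s_i$ are symmetric), and the valency of $s_i$ is $n_i=|\{y:(x,y)\in s_i\}|$. The maximal subgroups of $A$ are its $l$ subgroups of order $q^{r-1}$. -}

module Defs where

open import Level using (0ℓ)
open import Data.Bool using (Bool; true; false; _∧_; not; if_then_else_)
open import Data.Nat as ℕ using (ℕ; zero; suc; _^_; _∸_; _<_; NonZero)
open import Data.Nat.DivMod using (_mod_)
open import Data.Nat.Primality using (Prime)
open import Data.Fin using (Fin; toℕ)
import Data.Fin.Properties as FinP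
open import Data.List using (List; length; filterᵇ; cartesianProduct; allFin)
open import Data.Bool.ListAction using (any)
open import Data.List.Membership.Propositional using (_∈_)
open import Data.List.Relation.Unary.Unique.Propositional using (Unique)
open import Data.Product using (Σ; ∃; _×_; _,_)
open import Data.Integer using (+_)
open import Data.Rational using (ℚ; 0ℚ; _/_)
open import Relation.Nullary using (¬_; Dec; does)
open import Relation.Binary using (DecidableEquality)
open import Relation.Binary.PropositionalEquality using (_≡_; _≢_)
open import Data.Product.Properties using () renaming (≡-dec to ×-≡-dec)
open import Algebra.Structures using (IsCommutativeRing)

record FiniteField : Set₁ where
  infixl 6 _+_
  infixl 7 _*_
  field
    Carrier  : Set
    _+_ _*_  : Carrier → Carrier → Carrier
    -_       : Carrier → Carrier
    0# 1#    : Carrier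
    isCommutativeRing : IsCommutativeRing _≡_ _+_ _*_ -_ 0# 1#
    0≢1      : 0# ≢ 1#
    inverse  : ∀ x → x ≢ 0# → ∃ λ y → x * y ≡ 1#
    _≟_      : DecidableEquality Carrier
    elems    : List Carrier
    elems-complete : ∀ x → x ∈ elems
    elems-unique   : Unique elems

  size : ℕ
  size = length elems

  pow : Carrier → ℕ → Carrier
  pow x zero    = 1#
  pow x (suc n) = x * pow x n

IsPrimePower : ℕ → Set
IsPrimePower q = Σ ℕ λ p → Σ ℕ λ k → Prime p × 0 < k × q ≡ p ^ k

IsGenerator : (F : FiniteField) → FiniteField.Carrier F → Set
IsGenerator F σ = σ ≢ 0# × (∀ x → x ≢ 0# → ∃ λ k → pow σ k ≡ x)
  where open FiniteField F

count : {X : Set} → (X → Bool) → List X → ℕ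
count P xs = length (filterᵇ P xs)

-- Rational n/d, with the (irrelevant here) convention n/0 = 0.
frac : ℕ → ℕ → ℚ
frac n zero    = 0ℚ
frac n (suc d) = (+ n) / suc d

-- Subgroups of A = F^+ given as decidable subsets of F.

module _ (F : FiniteField) where
  open FiniteField F

  -- H is an F_q-subspace of F (F_q = {c : c^q = c}), i.e. an
  -- additive subgroup of F closed under multiplication by F_q.
  IsFqSubspace : ℕ → (Carrier → Bool) → Set
  IsFqSubspace q H =
    H 0# ≡ true ×
    (∀ x y → H x ≡ true → H y ≡ true → H (x + y) ≡ true) ×
    (∀ x → H x ≡ true → H (- x) ≡ true) ×
    (∀ c x → pow c q ≡ c → H x ≡ true → H (c * x) ≡ true)

  -- H is one of the maximal subgroups of A: an (F_q-)subgroup of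
  -- order q^(r-1)
  IsMaximalSubgroup : ℕ → ℕ → (Carrier → Bool) → Set
  IsMaximalSubgroup q r H =
    IsFqSubspace q H × count H elems ≡ q ^ (r ∸ 1)

  IsOrderingOfMaximalSubgroups :
    ℕ → ℕ → (l : ℕ) → (Fin l → Carrier → Bool) → Set
  IsOrderingOfMaximalSubgroups q r l A =
    (∀ i → IsMaximalSubgroup q r (A i)) ×
    (∀ i j → (∀ x → A i x ≡ A j x) → i ≡ j) ×
    (∀ H → IsMaximalSubgroup q r H → ∃ λ i → ∀ x → H x ≡ A i x)

-- The group G = A ⋊ ⟨τ⟩, τ = σ^(q-1), of order q^r · l.
-- The element a τ^i (a ∈ A, 0 ≤ i < l) is represented by (a , i).
-- (a τ^i)(b τ^j) = (a + τ^i b) τ^(i+j),  τ^l = 1.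

module Scheme (F : FiniteField) (q : ℕ) (σ : FiniteField.Carrier F)
              (l : ℕ) {{_ : NonZero l}}
              (A : Fin l → FiniteField.Carrier F → Bool) where
  open FiniteField F

  τ : Carrier
  τ = pow σ (q ∸ 1)

  G : Set
  G = Carrier × Fin l

  _·_ : G → G → G
  (a , i) · (b , j) = (a + pow τ (toℕ i) * b , (toℕ i ℕ.+ toℕ j) mod l)

  1G : G
  1G = (0# , 0 mod l)

  _≟G_ : DecidableEquality G
  _≟G_ = ×-≡-dec _≟_ FinP._≟_

  elemsG : List G
  elemsG = cartesianProduct elems (allFin l)

  isZeroF : Carrier → Bool
  isZeroF a = does (a ≟ 0#)

  isZeroFin : Fin l → Bool
  isZeroFin i = does (toℕ i ℕ.≟ 0)

  X₀ : G → Bool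
  X₀ (a , i) = isZeroFin i ∧ isZeroF a
  X₁ : G → Bool
  X₁ (a , i) = isZeroFin i ∧ A i a ∧ not (isZeroF a)
  X₂ : G → Bool
  X₂ (a , i) = isZeroFin i ∧ not (A i a)
  X₃ : G → Bool
  X₃ (a , i) = not (isZeroFin i) ∧ A i a
  X₄ : G → Bool
  X₄ (a , i) = not (isZeroFin i) ∧ not (A i a)

  W : G → Bool
  W (a , i) = not (A i a)

  InverseClosed : (G → Bool) → Set
  InverseClosed X = ∀ g h → X g ≡ true → g · h ≡ 1G → X h ≡ true

  -- (g , h) ∈ s(X) = {(g , x g) : x ∈ X, g ∈ G}
  inS : (G → Bool) → G → G → Bool
  inS X g h = any (λ x → X x ∧ does (h ≟G (x · g))) elemsG

  -- |{z : (x,z) ∈ s(X), (z,y) ∈ s(Y)}|  (intersection number c_{XY}^k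
  -- when (x,y) ∈ s_k)
  c : (G → Bool) → (G → Bool) → G → G → ℕ
  c X Y x y = count (λ z → inS X x z ∧ inS Y z y) elemsG

  valency : (G → Bool) → G → ℕ
  valency X x = count (λ y → inS X x y) elemsG

  card : (G → Bool) → ℕ
  card X = count X elemsG

module Submission where

-- The valencies are n₁ = q^(r-1) - 1, n₂ = q^r - q^(r-1), n₃ = (l-1) q^(r-1) and
-- n₄ = (l-1)(q^r - q^(r-1)); with l(q-1) = q^r - 1 this turns (2)-(4) into identities between
-- fractions.  For (1), c₃₃ at (x , y) counts the a ∈ X₃ with (y x⁻¹) a⁻¹ ∈ X₃.  If y x⁻¹ = zτᵏ
-- with k ≠ 0 (as for every pair in s₃ or s₄), the a = bτⁱ with i ∉ {0 , k} are those with
-- b ∈ A_i ∩ (c - A_(i-k)) for some c, since inverse-closedness forces A_(-j) = τ^(-j) A_j.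
-- Distinct hyperplanes H, H′ of the F_q-space F meet every coset c - H′ in q^(r-2) points, so
-- c₃₃ = (l-2) q^(r-2) on s₃ and s₄ alike.  F_q-linearity is only available through the q
-- Frobenius-fixed elements 0, σ^(lm); the joint stabiliser K of H and H′ is a ring containing
-- them, and for x ∈ H′ ∖ H the decomposition F = H ⊕ K x forces |K| = q.

open import Level using (0ℓ)
open import Data.Bool using (Bool; true; false; _∧_; not; if_then_else_)
import Data.Bool as Bool
open import Data.Bool.ListAction using (any)
open import Data.Bool.Properties using (T-≡; not-¬; ¬-not; not-injective; ∧-commutativeMonoid)
open import Data.Nat as ℕ using (ℕ; zero; suc; NonZero; z≤n; s≤s; _∸_; _^_; _≤_; _<_)
import Data.Nat.Properties as ℕ
open import Data.Nat.DivMod using (_%_; _/_; _mod_; m%n<n; m≡m%n+[m/n]*n; %-distribˡ-+; m%n%n≡m%n; m<n⇒m%n≡m; n%n≡0)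
open import Data.Nat.Primality using (prime⇒nonTrivial)
open import Data.Nat.Tactic.RingSolver using (solve-∀)
import Data.Integer as ℤ
import Data.Integer.Properties as ℤ
open import Data.Rational using (ℚ; 1ℚ; toℚᵘ) renaming (_+_ to _+ℚ_; _-_ to _-ℚ_)
import Data.Rational.Properties as ℚ
import Data.Rational.Unnormalised as ℚᵘ
import Data.Rational.Unnormalised.Properties as ℚᵘ
open import Data.Fin as Fin using (Fin; toℕ)
open import Data.Fin.Properties using (toℕ-fromℕ<; toℕ-injective; toℕ<n; injective⇒≤)
open import Data.List using (List; []; _∷_; _++_; length; map; filterᵇ; lookup; allFin; applyUpTo; cartesianProduct; cartesianProductWith)
open import Data.List.Properties using (filter-++; length-++; length-map; length-applyUpTo; length-tabulate)
open import Data.List.Membership.Propositional using (_∈_; lose)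
open import Data.List.Membership.Propositional.Properties
  using (∈-lookup; ∈-filter⁺; ∈-filter⁻; ∈-map⁺; ∈-map⁻; ∈-cartesianProductWith⁺; ∈-cartesianProductWith⁻;
         ∈-cartesianProduct⁺; ∈-cartesianProduct⁻; ∈-applyUpTo⁺; ∈-applyUpTo⁻; ∈-allFin)
open import Data.List.Membership.Propositional.Properties.WithK using (unique∧set⇒bag)
open import Data.List.Relation.Unary.Any using (here; there; index; any?; satisfied)
open import Data.List.Relation.Unary.Any.Properties using (lookup-index; any⁺; any⁻)
open import Data.List.Relation.Unary.All as All using (All; []; _∷_)
import Data.List.Relation.Unary.All.Properties as All
open import Data.List.Relation.Unary.AllPairs using ([]; _∷_)
open import Data.List.Relation.Unary.Unique.Propositional using (Unique)
import Data.List.Relation.Unary.Unique.Propositional.Properties as Unique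
open import Data.List.Relation.Binary.Subset.Propositional using (_⊆_)
open import Data.List.Relation.Binary.BagAndSetEquality using (∼bag⇒↭)
open import Data.List.Relation.Binary.Permutation.Propositional.Properties using (↭-length; filter-↭)
open import Data.Product using (∃; ∃₂; _×_; _,_; proj₁; proj₂)
open import Data.Empty using (⊥-elim)
open import Function using (_∘_; _⇔_; mk⇔; Equivalence)
open import Function.Properties.Equivalence using () renaming (trans to ⇔-trans)
open import Relation.Nullary using (¬_; Dec; does; yes; no; T?)
open import Relation.Nullary.Decidable using (map′; _×-dec_; _→-dec_)
open import Relation.Binary using (DecidableEquality)
open import Relation.Binary.PropositionalEquality hiding (J)
open import Algebra.Bundles using (CommutativeRing; Ring; CommutativeMonoid; Group)
open import Algebra.Structures using (IsGroup)
import Algebra.Properties.Group as GroupProperties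
import Algebra.Properties.AbelianGroup as AbelianGroupProperties
import Algebra.Properties.RingWithoutOne as RingProperties
open import Algebra.Properties.CommutativeSemigroup (CommutativeMonoid.commutativeSemigroup ∧-commutativeMonoid)
  using () renaming (interchange to ∧-interchange)
open import Defs

module Counting where
  open import Data.Nat using (_+_; _*_; _∸_; _≤_; _<_)
  open import Data.Nat.Properties using (+-suc; ≤-antisym; ≤-refl; ≤-trans; ≤-reflexive; <⇒≱; m+n∸m≡n)

  does≡true⇔ : {A : Set} (a? : Dec A) → does a? ≡ true ⇔ A
  does≡true⇔ (yes a) = mk⇔ (λ _ → a) (λ _ → refl)
  does≡true⇔ (no ¬a) = mk⇔ (λ ()) (λ a → ⊥-elim (¬a a))

  does≡false⇔ : {A : Set} (a? : Dec A) → does a? ≡ false ⇔ (¬ A)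
  does≡false⇔ (yes a) = mk⇔ (λ ()) (λ ¬a → ⊥-elim (¬a a))
  does≡false⇔ (no ¬a) = mk⇔ (λ _ → ¬a) (λ _ → refl)

  ∧≡true⇔ : {a b : Bool} → a ∧ b ≡ true ⇔ (a ≡ true × b ≡ true)
  ∧≡true⇔ {true}  = mk⇔ (λ b≡true → refl , b≡true) proj₂
  ∧≡true⇔ {false} = mk⇔ (λ ()) (λ ())

  ≡true⇔⇒≡ : {a b : Bool} → (a ≡ true ⇔ b ≡ true) → a ≡ b
  ≡true⇔⇒≡ {true}  {b}     a⇔b = sym (Equivalence.to a⇔b refl)
  ≡true⇔⇒≡ {false} {true}  a⇔b = Equivalence.from a⇔b refl
  ≡true⇔⇒≡ {false} {false} a⇔b = refl

  private
    variable
      X : Set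

  module _ {P Q : X → Bool} where

    count-cong : P ≗ Q → ∀ xs → count P xs ≡ count Q xs
    count-cong P≗Q [] = refl
    count-cong P≗Q (x ∷ xs) with P x | Q x | P≗Q x | count-cong P≗Q xs
    ... | true  | true  | _ | eq = cong suc eq
    ... | false | false | _ | eq = eq

    count-split : ∀ xs → count P xs ≡ count (λ x → P x ∧ Q x) xs + count (λ x → P x ∧ not (Q x)) xs
    count-split [] = refl
    count-split (x ∷ xs) with P x | Q x | count-split xs
    ... | true  | true  | eq = cong suc eq
    ... | true  | false | eq = trans (cong suc eq) (sym (+-suc _ _))
    ... | false | _     | eq = eq

  count-++ : (P : X → Bool) (xs ys : List X) → count P (xs ++ ys) ≡ count P xs + count P ys
  count-++ P xs ys = trans (cong length (filter-++ (T? ∘ P) xs ys)) (length-++ (filterᵇ P xs))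

  count-map : {Y : Set} (P : Y → Bool) (f : X → Y) (xs : List X) → count P (map f xs) ≡ count (P ∘ f) xs
  count-map P f [] = refl
  count-map P f (x ∷ xs) with P (f x)
  ... | true  = cong suc (count-map P f xs)
  ... | false = count-map P f xs

  count-∧ˡ : (b : Bool) (P : X → Bool) (xs : List X) → count (λ x → b ∧ P x) xs ≡ (if b then count P xs else 0)
  count-∧ˡ true  P xs = refl
  count-∧ˡ false P []       = refl
  count-∧ˡ false P (x ∷ xs) = count-∧ˡ false P xs

  count-Unique-⇔ : (P : X → Bool) {xs ys : List X} → Unique xs → Unique ys → (∀ {x} → x ∈ xs ⇔ x ∈ ys) →
                   count P xs ≡ count P ys
  count-Unique-⇔ P xs-unique ys-unique xs⇔ys =
    ↭-length (filter-↭ (T? ∘ P) (∼bag⇒↭ (unique∧set⇒bag xs-unique ys-unique xs⇔ys)))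

  ∈-filterᵇ⁺ : {P : X → Bool} {x : X} {xs : List X} → x ∈ xs → P x ≡ true → x ∈ filterᵇ P xs
  ∈-filterᵇ⁺ {P = P} x∈xs Px = ∈-filter⁺ (T? ∘ P) x∈xs (Equivalence.from T-≡ Px)

  ∈-filterᵇ⁻ : {P : X → Bool} {x : X} (xs : List X) → x ∈ filterᵇ P xs → x ∈ xs × P x ≡ true
  ∈-filterᵇ⁻ {P = P} xs x∈ with ∈-filter⁻ (T? ∘ P) {xs = xs} x∈
  ... | x∈xs , Px = x∈xs , Equivalence.to T-≡ Px

  any≡true⇒ : {p : X → Bool} (xs : List X) → any p xs ≡ true → ∃ λ x → p x ≡ true
  any≡true⇒ {p = p} xs any≡true with satisfied (any⁻ p xs (Equivalence.from T-≡ any≡true))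
  ... | x , px = x , Equivalence.to T-≡ px

  ∈⇒any≡true : {p : X → Bool} {x : X} {xs : List X} → x ∈ xs → p x ≡ true → any p xs ≡ true
  ∈⇒any≡true {p = p} x∈xs px = Equivalence.to T-≡ (any⁺ p (lose x∈xs (Equivalence.from T-≡ px)))

  lookup-injective : {xs : List X} → Unique xs → ∀ {i j} → lookup xs i ≡ lookup xs j → i ≡ j
  lookup-injective {xs = x ∷ xs} _              {Fin.zero}  {Fin.zero}  _  = refl
  lookup-injective {xs = x ∷ xs} (x∉xs ∷ _)     {Fin.zero}  {Fin.suc j} eq = ⊥-elim (All.lookup x∉xs (∈-lookup j) eq)
  lookup-injective {xs = x ∷ xs} (x∉xs ∷ _)     {Fin.suc i} {Fin.zero}  eq = ⊥-elim (All.lookup x∉xs (∈-lookup i) (sym eq))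
  lookup-injective {xs = x ∷ xs} (_ ∷ xs-unique) {Fin.suc i} {Fin.suc j} eq = cong Fin.suc (lookup-injective xs-unique eq)

  Unique-⊆⇒length≤ : {xs ys : List X} → Unique xs → xs ⊆ ys → length xs ≤ length ys
  Unique-⊆⇒length≤ {xs = xs} {ys} xs-unique xs⊆ys = injective⇒≤ position-injective
    where
    position : Fin (length xs) → Fin (length ys)
    position i = index (xs⊆ys (∈-lookup i))
    position-injective : ∀ {i j} → position i ≡ position j → i ≡ j
    position-injective {i} {j} eq = lookup-injective xs-unique (begin
      lookup xs i                 ≡⟨ lookup-index (xs⊆ys (∈-lookup i)) ⟩
      lookup ys (position i)      ≡⟨ cong (lookup ys) eq ⟩
      lookup ys (position j)      ≡⟨ sym (lookup-index (xs⊆ys (∈-lookup j))) ⟩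
      lookup xs j                 ∎)
      where open ≡-Reasoning

  module Enumerated (xs : List X) (complete : ∀ x → x ∈ xs) (unique : Unique xs) where

    #_ : (X → Bool) → ℕ
    # P = count P xs

    #-cong : {P Q : X → Bool} → P ≗ Q → # P ≡ # Q
    #-cong P≗Q = count-cong P≗Q xs

    length≤# : (P : X → Bool) {ys : List X} → Unique ys → (∀ {y} → y ∈ ys → P y ≡ true) → length ys ≤ # P
    length≤# P ys-unique ys⊆P =
      Unique-⊆⇒length≤ ys-unique (λ {y} y∈ys → ∈-filterᵇ⁺ {P = P} (complete y) (ys⊆P y∈ys))

    #≤length : (P : X → Bool) (ys : List X) → (∀ x → P x ≡ true → x ∈ ys) → # P ≤ length ys
    #≤length P ys P⊆ys = Unique-⊆⇒length≤ (Unique.filter⁺ (T? ∘ P) unique)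
                                            (λ {x} x∈ → P⊆ys x (proj₂ (∈-filterᵇ⁻ xs x∈)))

    #-true : # (λ _ → true) ≡ length xs
    #-true = go xs
      where
      go : ∀ ys → count (λ _ → true) ys ≡ length ys
      go []       = refl
      go (_ ∷ ys) = cong suc (go ys)

    #-complement : (P : X → Bool) → # P + # (not ∘ P) ≡ length xs
    #-complement P = trans (sym (count-split {P = λ _ → true} {Q = P} xs)) #-true

    #-remove-single : (P Q : X → Bool) → # (λ x → P x ∧ Q x) ≡ 1 → # (λ x → P x ∧ not (Q x)) ≡ # P ∸ 1
    #-remove-single P Q #P∧Q≡1 = sym (begin
      # P ∸ 1                                                ≡⟨ cong (_∸ 1) (count-split {P = P} {Q = Q} xs) ⟩
      # (λ x → P x ∧ Q x) + # (λ x → P x ∧ not (Q x)) ∸ 1    ≡⟨ cong (λ n → n + # (λ x → P x ∧ not (Q x)) ∸ 1) #P∧Q≡1 ⟩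
      1 + # (λ x → P x ∧ not (Q x)) ∸ 1                      ≡⟨ m+n∸m≡n 1 _ ⟩
      # (λ x → P x ∧ not (Q x))                              ∎)
      where open ≡-Reasoning

    #-bijection : (P : X → Bool) (f g : X → X) → (∀ x → g (f x) ≡ x) → (∀ x → f (g x) ≡ x) → # (P ∘ f) ≡ # P
    #-bijection P f g gf fg = begin
      count (P ∘ f) xs    ≡⟨ count-map P f xs ⟨
      count P (map f xs)  ≡⟨ count-Unique-⇔ P map-unique unique (mk⇔ (λ _ → complete _) map-complete) ⟩
      count P xs          ∎
      where
      open ≡-Reasoning
      map-unique : Unique (map f xs)
      map-unique = Unique.map⁺ (λ {x} {y} fx≡fy → trans (sym (gf x)) (trans (cong g fx≡fy) (gf y))) unique
      map-complete : ∀ {x} → x ∈ xs → x ∈ map f xs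
      map-complete {x} _ = subst (_∈ map f xs) (fg x) (∈-map⁺ f (complete (g x)))

    #-single : (P : X → Bool) (a : X) → (∀ x → P x ≡ true ⇔ x ≡ a) → # P ≡ 1
    #-single P a P⇔≡a = ≤-antisym
      (#≤length P (a ∷ []) (λ x Px → here (Equivalence.to (P⇔≡a x) Px)))
      (length≤# P ([] ∷ []) λ { (here refl) → Equivalence.from (P⇔≡a a) refl })

    ⊆∧#≤⇒⊇ : {P Q : X → Bool} → (∀ x → P x ≡ true → Q x ≡ true) → # Q ≤ # P → ∀ x → Q x ≡ true → P x ≡ true
    ⊆∧#≤⇒⊇ {P} {Q} P⊆Q #Q≤#P x Qx with P x in Px
    ... | true  = refl
    ... | false = ⊥-elim (<⇒≱ #P<#Q #Q≤#P)
      where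
      x∉P : All (x ≢_) (filterᵇ P xs)
      x∉P = All.tabulate λ y∈ → λ { refl → not-¬ Px (proj₂ (∈-filterᵇ⁻ xs y∈)) }
      #P<#Q : # P < # Q
      #P<#Q = length≤# Q (x∉P ∷ Unique.filter⁺ (T? ∘ P) unique)
                λ { (here refl) → Qx ; (there y∈) → P⊆Q _ (proj₂ (∈-filterᵇ⁻ xs y∈)) }

    #≡∧≢⇒difference : {P Q : X → Bool} → # P ≡ # Q → ¬ (P ≗ Q) → ∃ λ x → Q x ≡ true × P x ≡ false
    #≡∧≢⇒difference {P} {Q} #P≡#Q P≢Q with any? (λ x → (Q x Bool.≟ true) ×-dec (P x Bool.≟ false)) xs
    ... | yes found = satisfied found
    ... | no none   = ⊥-elim (P≢Q λ x → ≡true⇔⇒≡ (mk⇔ (⊆∧#≤⇒⊇ Q⊆P (≤-reflexive #P≡#Q) x) (Q⊆P x)))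
      where
      Q⊆P : ∀ x → Q x ≡ true → P x ≡ true
      Q⊆P x Qx with P x in Px
      ... | true  = refl
      ... | false = ⊥-elim (none (lose (complete x) (Qx , Px)))

    #≤length⇒⊇ : DecidableEquality X → (P : X → Bool) {ys : List X} → Unique ys → (∀ {y} → y ∈ ys → P y ≡ true) →
                 # P ≤ length ys → ∀ x → P x ≡ true → x ∈ ys
    #≤length⇒⊇ _≟_ P {ys} ys-unique ys⊆P #P≤ x Px with any? (x ≟_) ys
    ... | yes x∈ys = x∈ys
    ... | no  x∉ys = ⊥-elim (<⇒≱ (s≤s ≤-refl) (≤-trans (length≤# P x∷ys-unique x∷ys⊆P) #P≤))
      where
      x∷ys-unique : Unique (x ∷ ys)
      x∷ys-unique = All.tabulate (λ y∈ys x≡y → x∉ys (subst (_∈ ys) (sym x≡y) y∈ys)) ∷ ys-unique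
      x∷ys⊆P : ∀ {y} → y ∈ x ∷ ys → P y ≡ true
      x∷ys⊆P (here refl) = Px
      x∷ys⊆P (there y∈) = ys⊆P y∈

  count-by-index : {X I : Set} {xs : List X} {is : List I} → Unique xs → Unique is →
                   (P : X × I → Bool) (R : I → Bool) (m : ℕ) →
                   (∀ i → count (λ a → P (a , i)) xs ≡ (if R i then m else 0)) →
                   count P (cartesianProduct xs is) ≡ count R is * m
  count-by-index {X} {I} {xs} {is} xs-unique is-unique P R m fibre =
    trans (count-Unique-⇔ P (Unique.cartesianProduct⁺ xs-unique is-unique) index-major-unique
            (mk⇔ to-index-major from-index-major))
          (count-index-major is)
    where
    index-major : List I → List (X × I)
    index-major js = cartesianProductWith (λ i a → a , i) js xs

    index-major-unique : Unique (index-major is)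
    index-major-unique = Unique.cartesianProductWith⁺ (λ i a → a , i) (λ { refl → refl , refl }) is-unique xs-unique

    to-index-major : ∀ {v} → v ∈ cartesianProduct xs is → v ∈ index-major is
    to-index-major v∈ with ∈-cartesianProductWith⁻ _,_ xs is v∈
    ... | a , i , a∈ , i∈ , refl = ∈-cartesianProductWith⁺ (λ i a → a , i) i∈ a∈

    from-index-major : ∀ {v} → v ∈ index-major is → v ∈ cartesianProduct xs is
    from-index-major v∈ with ∈-cartesianProductWith⁻ (λ i a → a , i) is xs v∈
    ... | i , a , i∈ , a∈ , refl = ∈-cartesianProduct⁺ a∈ i∈

    count-index-major : ∀ js → count P (index-major js) ≡ count R js * m
    count-index-major []       = refl
    count-index-major (i ∷ js) = begin
      count P (map (λ a → a , i) xs ++ index-major js)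
        ≡⟨ count-++ P (map (λ a → a , i) xs) (index-major js) ⟩
      count P (map (λ a → a , i) xs) + count P (index-major js)
        ≡⟨ cong₂ _+_ (trans (count-map P (λ a → a , i) xs) (fibre i)) (count-index-major js) ⟩
      (if R i then m else 0) + count R js * m
        ≡⟨ fibre-step ⟩
      count R (i ∷ js) * m ∎
      where
      open ≡-Reasoning
      fibre-step : (if R i then m else 0) + count R js * m ≡ count R (i ∷ js) * m
      fibre-step with R i
      ... | true  = refl
      ... | false = refl

  Unique-map⁺ : {X Y : Set} {f : X → Y} {xs : List X} → Unique xs →
                (∀ {a b} → a ∈ xs → b ∈ xs → f a ≡ f b → a ≡ b) → Unique (map f xs)
  Unique-map⁺ []                 _   = []
  Unique-map⁺ (a∉xs ∷ xs-unique) inj =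
    All.map⁺ (All.tabulate λ b∈xs fa≡fb → All.lookup a∉xs b∈xs (inj (here refl) (there b∈xs) fa≡fb))
    ∷ Unique-map⁺ xs-unique (λ a∈ b∈ → inj (there a∈) (there b∈))

  length-cartesianProduct : {X Y : Set} (xs : List X) (ys : List Y) → length (cartesianProduct xs ys) ≡ length xs * length ys
  length-cartesianProduct []       ys = refl
  length-cartesianProduct (x ∷ xs) ys =
    trans (length-++ (map (x ,_) ys)) (cong₂ _+_ (length-map (x ,_) ys) (length-cartesianProduct xs ys))

open Counting

module FieldFacts (F : FiniteField) where
  open FiniteField F public

  ring : CommutativeRing 0ℓ 0ℓ
  ring = record { isCommutativeRing = isCommutativeRing }

  open CommutativeRing ring public
    using (_-_; +-assoc; +-comm; +-identityˡ; +-identityʳ; -‿inverseˡ; -‿inverseʳ;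
           *-assoc; *-comm; *-identityˡ; *-identityʳ; distribˡ; distribʳ; zeroˡ; zeroʳ; +-group)
  open GroupProperties +-group public using ()
    renaming (∙-cancelˡ to +-cancelˡ; ∙-cancelʳ to +-cancelʳ; ⁻¹-involutive to -‿involutive; ⁻¹-injective to -‿injective;
              x∙y⁻¹≈ε⇒x≈y to x-y≡0⇒x≡y)
  open AbelianGroupProperties (CommutativeRing.+-abelianGroup ring) public using () renaming (xyx⁻¹≈y to x+y-x≡y)
  open GroupProperties +-group using (\\-leftDividesʳ; //-rightDividesʳ)
  open RingProperties (Ring.ringWithoutOne (CommutativeRing.ring ring)) public using (-‿distribˡ-*; -‿distribʳ-*)
  open Enumerated elems elems-complete elems-unique public

  +-transpose : ∀ {a b c d} → a + b ≡ c + d → b - d ≡ c - a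
  +-transpose {a} {b} {c} {d} a+b≡c+d = begin
    b - d                ≡⟨ cong (_- d) (\\-leftDividesʳ a b) ⟨
    (- a + (a + b)) - d  ≡⟨ cong (λ z → (- a + z) - d) a+b≡c+d ⟩
    (- a + (c + d)) - d  ≡⟨ cong (_- d) (+-assoc (- a) c d) ⟨
    (- a + c + d) - d    ≡⟨ //-rightDividesʳ d (- a + c) ⟩
    - a + c              ≡⟨ +-comm (- a) c ⟩
    c - a                ∎
    where open ≡-Reasoning

  st≡1⇒s[ty]≡y : ∀ {s t} → s * t ≡ 1# → ∀ y → s * (t * y) ≡ y
  st≡1⇒s[ty]≡y {s} {t} st≡1 y = trans (sym (*-assoc s t y)) (trans (cong (_* y) st≡1) (*-identityˡ y))

  *-cancelˡ : ∀ {a} x y → a ≢ 0# → a * x ≡ a * y → x ≡ y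
  *-cancelˡ {a} x y a≢0 ax≡ay with inverse a a≢0
  ... | a⁻¹ , aa⁻¹≡1 = begin
    x               ≡⟨ st≡1⇒s[ty]≡y a⁻¹a≡1 x ⟨
    a⁻¹ * (a * x)   ≡⟨ cong (a⁻¹ *_) ax≡ay ⟩
    a⁻¹ * (a * y)   ≡⟨ st≡1⇒s[ty]≡y a⁻¹a≡1 y ⟩
    y               ∎
    where
    open ≡-Reasoning
    a⁻¹a≡1 = trans (*-comm a⁻¹ a) aa⁻¹≡1

  *≢0 : ∀ {x y} → x ≢ 0# → y ≢ 0# → x * y ≢ 0#
  *≢0 {x} {y} x≢0 y≢0 xy≡0 = y≢0 (*-cancelˡ y 0# x≢0 (trans xy≡0 (sym (zeroʳ x))))

  pow-+ : ∀ x m n → pow x (m ℕ.+ n) ≡ pow x m * pow x n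
  pow-+ x zero    n = sym (*-identityˡ _)
  pow-+ x (suc m) n = trans (cong (x *_) (pow-+ x m n)) (sym (*-assoc x _ _))

  pow-* : ∀ x m n → pow x (m ℕ.* n) ≡ pow (pow x m) n
  pow-* x m zero    = cong (pow x) (ℕ.*-zeroʳ m)
  pow-* x m (suc n) = begin
    pow x (m ℕ.* suc n)         ≡⟨ cong (pow x) (ℕ.*-suc m n) ⟩
    pow x (m ℕ.+ m ℕ.* n)       ≡⟨ pow-+ x m (m ℕ.* n) ⟩
    pow x m * pow x (m ℕ.* n)   ≡⟨ cong (pow x m *_) (pow-* x m n) ⟩
    pow x m * pow (pow x m) n   ∎
    where open ≡-Reasoning

  pow-1# : ∀ n → pow 1# n ≡ 1#
  pow-1# zero    = refl
  pow-1# (suc n) = trans (*-identityˡ _) (pow-1# n)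

  pow≢0 : ∀ {x} n → x ≢ 0# → pow x n ≢ 0#
  pow≢0 zero    x≢0 1≡0 = 0≢1 (sym 1≡0)
  pow≢0 (suc n) x≢0     = *≢0 x≢0 (pow≢0 n x≢0)

  pow-mod : ∀ {x d} .{{_ : ℕ.NonZero d}} → pow x d ≡ 1# → ∀ m → pow x (m % d) ≡ pow x m
  pow-mod {x} {d} xᵈ≡1 m = begin
    pow x (m % d)                                ≡⟨ *-identityʳ _ ⟨
    pow x (m % d) * 1#                           ≡⟨ cong (pow x (m % d) *_) (trans (cong (λ z → pow z (m / d)) xᵈ≡1) (pow-1# (m / d))) ⟨
    pow x (m % d) * pow (pow x d) (m / d)        ≡⟨ cong (pow x (m % d) *_) (pow-* x d (m / d)) ⟨
    pow x (m % d) * pow x (d ℕ.* (m / d))        ≡⟨ pow-+ x (m % d) _ ⟨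
    pow x (m % d ℕ.+ d ℕ.* (m / d))              ≡⟨ cong (λ z → pow x (m % d ℕ.+ z)) (ℕ.*-comm d (m / d)) ⟩
    pow x (m % d ℕ.+ (m / d) ℕ.* d)              ≡⟨ cong (pow x) (m≡m%n+[m/n]*n m d) ⟨
    pow x m                                      ∎
    where open ≡-Reasoning

  #-scale : (P : Carrier → Bool) {s t : Carrier} → s * t ≡ 1# → # (λ b → P (s * b)) ≡ # P
  #-scale P {s} {t} st≡1 = #-bijection P (s *_) (t *_) (st≡1⇒s[ty]≡y (trans (*-comm t s) st≡1)) (st≡1⇒s[ty]≡y st≡1)

  #-zero : # (λ x → does (x ≟ 0#)) ≡ 1
  #-zero = #-single (λ x → does (x ≟ 0#)) 0# (λ x → does≡true⇔ (x ≟ 0#))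

module GeneratorOrder (F : FiniteField) {σ : FiniteField.Carrier F} (generator : IsGenerator F σ) where
  open FieldFacts F

  N : ℕ
  N = size ∸ 1

  nonzero : Carrier → Bool
  nonzero x = not (does (x ≟ 0#))

  #nonzero : # nonzero ≡ N
  #nonzero = trans (#-remove-single (λ _ → true) (λ x → does (x ≟ 0#)) #-zero) (cong (_∸ 1) #-true)

  nonzero⇒≢0 : ∀ {x} → nonzero x ≡ true → x ≢ 0#
  nonzero⇒≢0 {x} eq = Equivalence.to (does≡false⇔ (x ≟ 0#)) (not-injective eq)

  ≢0⇒nonzero : ∀ {x} → x ≢ 0# → nonzero x ≡ true
  ≢0⇒nonzero {x} x≢0 = cong not (Equivalence.from (does≡false⇔ (x ≟ 0#)) x≢0)

  σ≢0 : σ ≢ 0#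
  σ≢0 = proj₁ generator

  pow-σ-≡⇒period : ∀ {a b} → a ≤ b → pow σ a ≡ pow σ b → pow σ (b ∸ a) ≡ 1#
  pow-σ-≡⇒period {a} {b} a≤b σᵃ≡σᵇ = *-cancelˡ _ _ (pow≢0 a σ≢0) (begin
    pow σ a * pow σ (b ∸ a)  ≡⟨ pow-+ σ a (b ∸ a) ⟨
    pow σ (a ℕ.+ (b ∸ a))    ≡⟨ cong (pow σ) (ℕ.m+[n∸m]≡n a≤b) ⟩
    pow σ b                  ≡⟨ σᵃ≡σᵇ ⟨
    pow σ a                  ≡⟨ *-identityʳ _ ⟨
    pow σ a * 1#             ∎)
    where open ≡-Reasoning

  period-bound : ∀ {d} → 0 < d → pow σ d ≡ 1# → N ≤ d
  period-bound {d} d>0 σᵈ≡1 = subst₂ _≤_ #nonzero (length-applyUpTo (pow σ) d) (#≤length nonzero (applyUpTo (pow σ) d) covered)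
    where
    instance _ = ℕ.>-nonZero d>0
    covered : ∀ x → nonzero x ≡ true → x ∈ applyUpTo (pow σ) d
    covered x x≢0 with proj₂ generator x (nonzero⇒≢0 x≢0)
    ... | k , refl = subst (_∈ applyUpTo (pow σ) d) (pow-mod σᵈ≡1 k) (∈-applyUpTo⁺ (pow σ) (m%n<n k d))

  pow-σ-injective : ∀ {a b} → a < b → b < N → pow σ a ≢ pow σ b
  pow-σ-injective {a} {b} a<b b<N σᵃ≡σᵇ =
    ℕ.<⇒≱ (ℕ.≤-<-trans (ℕ.m∸n≤m b a) b<N) (period-bound (ℕ.m<n⇒0<n∸m a<b) (pow-σ-≡⇒period (ℕ.<⇒≤ a<b) σᵃ≡σᵇ))

  powers : List Carrier
  powers = applyUpTo (pow σ) N

  nonzero⊆powers : ∀ x → nonzero x ≡ true → x ∈ powers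
  nonzero⊆powers = #≤length⇒⊇ _≟_ nonzero (Unique.applyUpTo⁺₁ (pow σ) N pow-σ-injective) powers-nonzero
                     (ℕ.≤-reflexive (trans #nonzero (sym (length-applyUpTo (pow σ) N))))
    where
    powers-nonzero : ∀ {y} → y ∈ powers → nonzero y ≡ true
    powers-nonzero y∈ with ∈-applyUpTo⁻ (pow σ) y∈
    ... | i , _ , refl = ≢0⇒nonzero (pow≢0 i σ≢0)

  -- σᴺ is one of the N distinct powers σ⁰ … σᴺ⁻¹ filling F^×, and only σ⁰ is possible.
  pow-σ-N : pow σ N ≡ 1#
  pow-σ-N with ∈-applyUpTo⁻ (pow σ) (nonzero⊆powers (pow σ N) (≢0⇒nonzero (pow≢0 N σ≢0)))
  ... | zero  , _   , σᴺ≡1  = σᴺ≡1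
  ... | suc a , a<N , σᴺ≡σᵃ = ⊥-elim (ℕ.<⇒≱ (ℕ.∸-monoʳ-< (s≤s z≤n) (ℕ.<⇒≤ a<N))
                                         (period-bound (ℕ.m<n⇒0<n∸m a<N) (pow-σ-≡⇒period (ℕ.<⇒≤ a<N) (sym σᴺ≡σᵃ))))

  module Subfield {q l : ℕ} .{{_ : ℕ.NonZero l}} (1≤q : 1 ≤ q) (l*[q∸1]≡N : l ℕ.* (q ∸ 1) ≡ N) where

    subfield : List Carrier
    subfield = 0# ∷ applyUpTo (λ m → pow σ (l ℕ.* m)) (q ∸ 1)

    subfield-length : length subfield ≡ q
    subfield-length = trans (cong suc (length-applyUpTo _ (q ∸ 1))) (ℕ.m+[n∸m]≡n 1≤q)

    subfield-unique : Unique subfield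
    subfield-unique = All.tabulate (λ y∈ 0≡y → nonzero-power y∈ (sym 0≡y)) ∷ Unique.applyUpTo⁺₁ _ (q ∸ 1) distinct
      where
      nonzero-power : ∀ {y} → y ∈ applyUpTo (λ m → pow σ (l ℕ.* m)) (q ∸ 1) → y ≢ 0#
      nonzero-power y∈ with ∈-applyUpTo⁻ _ y∈
      ... | m , _ , refl = pow≢0 (l ℕ.* m) σ≢0
      distinct : ∀ {i j} → i < j → j < q ∸ 1 → pow σ (l ℕ.* i) ≢ pow σ (l ℕ.* j)
      distinct {i} {j} i<j j<q-1 = pow-σ-injective (ℕ.*-monoʳ-< l i<j) (subst (l ℕ.* j <_) l*[q∸1]≡N (ℕ.*-monoʳ-< l j<q-1))

    subfield-fixed : ∀ {c} → c ∈ subfield → pow c q ≡ c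
    subfield-fixed (here refl) = pow-0# 1≤q
      where
      pow-0# : ∀ {n} → 1 ≤ n → pow 0# n ≡ 0#
      pow-0# {suc n} _ = zeroˡ _
    subfield-fixed (there c∈) with ∈-applyUpTo⁻ _ c∈
    ... | m , _ , refl = begin
      pow (pow σ (l ℕ.* m)) q                       ≡⟨ pow-* σ (l ℕ.* m) q ⟨
      pow σ (l ℕ.* m ℕ.* q)                         ≡⟨ cong (pow σ) exponent ⟩
      pow σ (l ℕ.* m ℕ.+ m ℕ.* N)                   ≡⟨ pow-+ σ (l ℕ.* m) (m ℕ.* N) ⟩
      pow σ (l ℕ.* m) * pow σ (m ℕ.* N)             ≡⟨ cong (pow σ (l ℕ.* m) *_) (trans (cong (pow σ) (ℕ.*-comm m N)) (pow-* σ N m)) ⟩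
      pow σ (l ℕ.* m) * pow (pow σ N) m             ≡⟨ cong (λ z → pow σ (l ℕ.* m) * pow z m) pow-σ-N ⟩
      pow σ (l ℕ.* m) * pow 1# m                    ≡⟨ cong (pow σ (l ℕ.* m) *_) (pow-1# m) ⟩
      pow σ (l ℕ.* m) * 1#                          ≡⟨ *-identityʳ _ ⟩
      pow σ (l ℕ.* m)                               ∎
      where
      open ≡-Reasoning
      exponent : l ℕ.* m ℕ.* q ≡ l ℕ.* m ℕ.+ m ℕ.* N
      exponent = begin
        l ℕ.* m ℕ.* q                      ≡⟨ cong (l ℕ.* m ℕ.*_) (ℕ.m+[n∸m]≡n 1≤q) ⟨
        l ℕ.* m ℕ.* (1 ℕ.+ (q ∸ 1))         ≡⟨ distribute l m (q ∸ 1) ⟩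
        l ℕ.* m ℕ.+ m ℕ.* (l ℕ.* (q ∸ 1))   ≡⟨ cong (λ z → l ℕ.* m ℕ.+ m ℕ.* z) l*[q∸1]≡N ⟩
        l ℕ.* m ℕ.+ m ℕ.* N                ∎
        where
        distribute : ∀ l m p → l ℕ.* m ℕ.* (1 ℕ.+ p) ≡ l ℕ.* m ℕ.+ m ℕ.* (l ℕ.* p)
        distribute = solve-∀

module Hyperplanes (F : FiniteField) {q : ℕ} {subfield : List (FiniteField.Carrier F)}
                   (subfield-unique : Unique subfield) (subfield-length : length subfield ≡ q)
                   (subfield-fixed : ∀ {c} → c ∈ subfield → FiniteField.pow F c q ≡ c) where
  open FieldFacts F

  module Subspace {H : Carrier → Bool} (H-subspace : IsFqSubspace F q H) where
    0∈ : H 0# ≡ true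
    0∈ = proj₁ H-subspace

    +-closed : ∀ {y z} → H y ≡ true → H z ≡ true → H (y + z) ≡ true
    +-closed = proj₁ (proj₂ H-subspace) _ _

    -‿closed : ∀ {y} → H y ≡ true → H (- y) ≡ true
    -‿closed = proj₁ (proj₂ (proj₂ H-subspace)) _

    subfield-closed : ∀ {c y} → c ∈ subfield → H y ≡ true → H (c * y) ≡ true
    subfield-closed c∈ = proj₂ (proj₂ (proj₂ H-subspace)) _ _ (subfield-fixed c∈)

  _stabilises_ : Carrier → (Carrier → Bool) → Set
  k stabilises H = ∀ y → H y ≡ true → H (k * y) ≡ true

  stabilises? : ∀ k H → Dec (k stabilises H)
  stabilises? k H = map′ (λ all y → All.lookup all (elems-complete y)) (λ k⊆ → All.tabulate (λ {y} _ → k⊆ y))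
                         (All.all? (λ y → (H y Bool.≟ true) →-dec (H (k * y) Bool.≟ true)) elems)

  module _ {H : Carrier → Bool} (H-subspace : IsFqSubspace F q H) where
    open Subspace H-subspace

    stabilises-+ : ∀ {k k′} → k stabilises H → k′ stabilises H → (k + k′) stabilises H
    stabilises-+ {k} {k′} kH kH′ y Hy = subst (λ z → H z ≡ true) (sym (distribʳ y k k′)) (+-closed (kH y Hy) (kH′ y Hy))

    stabilises-neg : ∀ {k} → k stabilises H → (- k) stabilises H
    stabilises-neg {k} kH y Hy = subst (λ z → H z ≡ true) (-‿distribˡ-* k y) (-‿closed (kH y Hy))

    subfield-stabilises : ∀ {c} → c ∈ subfield → c stabilises H
    subfield-stabilises c∈ y = subfield-closed c∈

    -- kH ⊆ H and |kH| = |H| force kH = H.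
    stabiliser-inverse : ∀ {k y} → k stabilises H → k ≢ 0# → H (k * y) ≡ true → H y ≡ true
    stabiliser-inverse {k} {y} kH k≢0 Hky =
      ⊆∧#≤⇒⊇ {P = H} {Q = λ z → H (k * z)} kH (ℕ.≤-reflexive (#-scale H (proj₂ (inverse k k≢0)))) y Hky

  module Decomposition {H H′ : Carrier → Bool} (H-subspace : IsFqSubspace F q H) (H′-subspace : IsFqSubspace F q H′)
                       (#H*q≡size : # H ℕ.* q ≡ size) {x : Carrier} (H′x : H′ x ≡ true) (Hx : H x ≡ false) where
    private
      module H  = Subspace H-subspace
      module H′ = Subspace H′-subspace

    Stab : Carrier → Set
    Stab k = k stabilises H × k stabilises H′

    stab : Carrier → Bool
    stab k = does (stabilises? k H ×-dec stabilises? k H′)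

    stab⇔ : ∀ k → stab k ≡ true ⇔ Stab k
    stab⇔ k = does≡true⇔ (stabilises? k H ×-dec stabilises? k H′)

    decomposition-injective : ∀ {h h′ k k′} → H h ≡ true → H h′ ≡ true → Stab k → Stab k′ →
                              h + k * x ≡ h′ + k′ * x → h ≡ h′ × k ≡ k′
    decomposition-injective {h} {h′} {k} {k′} Hh Hh′ (kH , kH′) (k′H , k′H′) eq with k ≟ k′
    ... | yes refl = +-cancelʳ (k * x) h h′ eq , refl
    ... | no k≢k′ = ⊥-elim (not-¬ Hx (stabiliser-inverse H-subspace (stabilises-+ H-subspace kH (stabilises-neg H-subspace k′H))
                                        (λ k-k′≡0 → k≢k′ (x-y≡0⇒x≡y k k′ k-k′≡0)) H[k-k′]x))
      where
      H[k-k′]x : H ((k - k′) * x) ≡ true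
      H[k-k′]x = subst (λ z → H z ≡ true) (sym (begin
        (k - k′) * x          ≡⟨ distribʳ x k (- k′) ⟩
        k * x + (- k′) * x    ≡⟨ cong (k * x +_) (-‿distribˡ-* k′ x) ⟨
        k * x - k′ * x        ≡⟨ +-transpose eq ⟩
        h′ - h                ∎)) (H.+-closed Hh′ (H.-‿closed Hh))
        where open ≡-Reasoning

    instance
      #H≢0 : ℕ.NonZero (# H)
      #H≢0 = ℕ.>-nonZero (length≤# H {ys = 0# ∷ []} ([] ∷ []) λ { (here refl) → H.0∈ })

    pairs : List (Carrier × Carrier)
    pairs = cartesianProduct (filterᵇ H elems) (filterᵇ stab elems)

    ∈-pairs : ∀ {h k} → (h , k) ∈ pairs → H h ≡ true × Stab k
    ∈-pairs hk∈ with ∈-cartesianProduct⁻ (filterᵇ H elems) (filterᵇ stab elems) hk∈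
    ... | h∈ , k∈ = proj₂ (∈-filterᵇ⁻ elems h∈) , Equivalence.to (stab⇔ _) (proj₂ (∈-filterᵇ⁻ elems k∈))

    compose : Carrier × Carrier → Carrier
    compose (h , k) = h + k * x

    compositions-unique : Unique (map compose pairs)
    compositions-unique =
      Unique-map⁺ (Unique.cartesianProduct⁺ (Unique.filter⁺ (T? ∘ H) elems-unique) (Unique.filter⁺ (T? ∘ stab) elems-unique))
        λ { {h , k} {h′ , k′} hk∈ hk′∈ eq → case-pair (∈-pairs hk∈) (∈-pairs hk′∈) eq }
      where
      case-pair : ∀ {h k h′ k′} → H h ≡ true × Stab k → H h′ ≡ true × Stab k′ →
                  h + k * x ≡ h′ + k′ * x → (h , k) ≡ (h′ , k′)
      case-pair (Hh , Sk) (Hh′ , Sk′) eq with decomposition-injective Hh Hh′ Sk Sk′ eq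
      ... | refl , refl = refl

    compositions-length : length (map compose pairs) ≡ # H ℕ.* # stab
    compositions-length = trans (length-map compose pairs) (length-cartesianProduct (filterᵇ H elems) (filterᵇ stab elems))

    #stab≡q : # stab ≡ q
    #stab≡q = ℕ.≤-antisym (ℕ.*-cancelˡ-≤ (# H) (begin
        # H ℕ.* # stab                ≡⟨ compositions-length ⟨
        length (map compose pairs)    ≤⟨ length≤# (λ _ → true) compositions-unique (λ _ → refl) ⟩
        # (λ _ → true)                ≡⟨ #-true ⟩
        size                          ≡⟨ #H*q≡size ⟨
        # H ℕ.* q                     ∎))
      (subst (_≤ # stab) subfield-length (length≤# stab subfield-unique
        (λ c∈ → Equivalence.from (stab⇔ _) (subfield-stabilises H-subspace c∈ , subfield-stabilises H′-subspace c∈))))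
      where open ℕ.≤-Reasoning

    decomposition : ∀ y → ∃₂ λ h k → H h ≡ true × Stab k × y ≡ h + k * x
    decomposition y with ∈-map⁻ compose (#≤length⇒⊇ _≟_ (λ _ → true) compositions-unique (λ _ → refl) size≤ y refl)
      where
      size≤ : # (λ _ → true) ≤ length (map compose pairs)
      size≤ = ℕ.≤-reflexive (sym (trans compositions-length (trans (cong (# H ℕ.*_) #stab≡q) (trans #H*q≡size (sym #-true)))))
    ... | (h , k) , hk∈ , refl = h , k , proj₁ (∈-pairs hk∈) , proj₂ (∈-pairs hk∈) , refl

    module Coset (c : Carrier) where
      S : Carrier → Bool
      S b = H b ∧ H′ (c - b)

      shifted : List (Carrier × Carrier)
      shifted = cartesianProduct (filterᵇ S elems) (filterᵇ stab elems)

      ∈-shifted : ∀ {b k} → (b , k) ∈ shifted → (H b ≡ true × H′ (c - b) ≡ true) × Stab k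
      ∈-shifted bk∈ with ∈-cartesianProduct⁻ (filterᵇ S elems) (filterᵇ stab elems) bk∈
      ... | b∈ , k∈ = Equivalence.to ∧≡true⇔ (proj₂ (∈-filterᵇ⁻ elems b∈)) ,
                      Equivalence.to (stab⇔ _) (proj₂ (∈-filterᵇ⁻ elems k∈))

      translate : Carrier × Carrier → Carrier
      translate (b , k) = c + (- b + k * x)

      translations-length : length (map translate shifted) ≡ # S ℕ.* q
      translations-length = trans (length-map translate shifted)
        (trans (length-cartesianProduct (filterᵇ S elems) (filterᵇ stab elems)) (cong (# S ℕ.*_) #stab≡q))

      translation∈H′ : ∀ {y} → y ∈ map translate shifted → H′ y ≡ true
      translation∈H′ y∈ with ∈-map⁻ translate y∈
      ... | (b , k) , bk∈ , refl with ∈-shifted bk∈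
      ...   | (_ , H′[c-b]) , (_ , kH′) =
        subst (λ z → H′ z ≡ true) (+-assoc c (- b) (k * x)) (H′.+-closed H′[c-b] (kH′ x H′x))

      translations-unique : Unique (map translate shifted)
      translations-unique =
        Unique-map⁺ (Unique.cartesianProduct⁺ (Unique.filter⁺ (T? ∘ S) elems-unique) (Unique.filter⁺ (T? ∘ stab) elems-unique))
          λ { {b , k} {b′ , k′} bk∈ bk′∈ eq → case-pair (∈-shifted bk∈) (∈-shifted bk′∈) (+-cancelˡ c _ _ eq) }
        where
        case-pair : ∀ {b k b′ k′} → (H b ≡ true × _) × Stab k → (H b′ ≡ true × _) × Stab k′ →
                    - b + k * x ≡ - b′ + k′ * x → (b , k) ≡ (b′ , k′)
        case-pair ((Hb , _) , Sk) ((Hb′ , _) , Sk′) eq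
          with decomposition-injective (H.-‿closed Hb) (H.-‿closed Hb′) Sk Sk′ eq
        ... | -b≡-b′ , refl = cong (_, _) (-‿injective -b≡-b′)

      H′⊆translations : ∀ y → H′ y ≡ true → y ∈ map translate shifted
      H′⊆translations y H′y with decomposition (c - y)
      ... | h , k , Hh , (kH , kH′) , c-y≡h+kx = subst (_∈ map translate shifted) translate≡y
        (∈-map⁺ translate (∈-cartesianProduct⁺ (∈-filterᵇ⁺ (elems-complete h) (Equivalence.from ∧≡true⇔ (Hh , H′[c-h])))
                                                (∈-filterᵇ⁺ (elems-complete (- k)) (Equivalence.from (stab⇔ _) Stab[-k]))))
        where
        Stab[-k] : Stab (- k)
        Stab[-k] = stabilises-neg H-subspace kH , stabilises-neg H′-subspace kH′
        c-h≡kx+y : c - h ≡ k * x + y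
        c-h≡kx+y = trans (sym (+-transpose (sym c-y≡h+kx))) (cong (k * x +_) (-‿involutive y))
        H′[c-h] : H′ (c - h) ≡ true
        H′[c-h] = subst (λ z → H′ z ≡ true) (sym c-h≡kx+y) (H′.+-closed (kH′ x H′x) H′y)
        translate≡y : translate (h , - k) ≡ y
        translate≡y = begin
          c + (- h + (- k) * x)     ≡⟨ +-assoc c (- h) _ ⟨
          (c - h) + (- k) * x       ≡⟨ cong₂ _+_ c-h≡kx+y (sym (-‿distribˡ-* k x)) ⟩
          (k * x + y) - k * x       ≡⟨ x+y-x≡y (k * x) y ⟩
          y                         ∎
          where open ≡-Reasoning

    coset-count : ∀ c → # (λ b → H b ∧ H′ (c - b)) ℕ.* q ≡ # H′
    coset-count c = ℕ.≤-antisym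
      (subst (_≤ # H′) translations-length (length≤# H′ translations-unique translation∈H′))
      (subst (# H′ ≤_) translations-length (#≤length H′ (map translate shifted) H′⊆translations))
      where open Coset c

  coset-intersection : ∀ {H H′} → IsFqSubspace F q H → IsFqSubspace F q H′ → # H ℕ.* q ≡ size → # H ≡ # H′ →
                       ¬ (H ≗ H′) → ∀ c → # (λ b → H b ∧ H′ (c - b)) ℕ.* q ≡ # H′
  coset-intersection H-subspace H′-subspace #H*q≡size #H≡#H′ H≢H′ with #≡∧≢⇒difference #H≡#H′ H≢H′
  ... | x , H′x , Hx = Decomposition.coset-count H-subspace H′-subspace #H*q≡size H′x Hx

-- ⊕ and 0F are literally the index parts of Scheme._·_ and Scheme.1G.
module Cyclic (l : ℕ) .{{_ : NonZero l}} where
  open import Data.Nat using (_+_)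

  infixl 6 _⊕_
  _⊕_ : Fin l → Fin l → Fin l
  i ⊕ j = (toℕ i + toℕ j) mod l

  0F : Fin l
  0F = 0 mod l

  ⊖_ : Fin l → Fin l
  ⊖ i = (l ∸ toℕ i) mod l

  toℕ-mod : ∀ m → toℕ (m mod l) ≡ m % l
  toℕ-mod m = toℕ-fromℕ< (m%n<n m l)

  toℕ-0F : toℕ 0F ≡ 0
  toℕ-0F = trans (toℕ-mod 0) (m<n⇒m%n≡m (ℕ.>-nonZero⁻¹ l))

  mod-cong : ∀ {m n} → m % l ≡ n % l → m mod l ≡ n mod l
  mod-cong {m} {n} eq = toℕ-injective (trans (toℕ-mod m) (trans eq (sym (toℕ-mod n))))

  [m%l+n]%l≡[m+n]%l : ∀ m n → (m % l + n) % l ≡ (m + n) % l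
  [m%l+n]%l≡[m+n]%l m n = begin
    (m % l + n) % l              ≡⟨ %-distribˡ-+ (m % l) n l ⟩
    (m % l % l + n % l) % l      ≡⟨ cong (λ z → (z + n % l) % l) (m%n%n≡m%n m l) ⟩
    (m % l + n % l) % l          ≡⟨ %-distribˡ-+ m n l ⟨
    (m + n) % l                  ∎
    where open ≡-Reasoning

  ⊕-comm : ∀ i j → i ⊕ j ≡ j ⊕ i
  ⊕-comm i j = cong (_mod l) (ℕ.+-comm (toℕ i) (toℕ j))

  ⊕-assoc : ∀ i j k → (i ⊕ j) ⊕ k ≡ i ⊕ (j ⊕ k)
  ⊕-assoc i j k = mod-cong (begin
    (toℕ (i ⊕ j) + toℕ k) % l              ≡⟨ cong (λ z → (z + toℕ k) % l) (toℕ-mod _) ⟩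
    ((toℕ i + toℕ j) % l + toℕ k) % l      ≡⟨ [m%l+n]%l≡[m+n]%l (toℕ i + toℕ j) (toℕ k) ⟩
    (toℕ i + toℕ j + toℕ k) % l            ≡⟨ cong (_% l) (ℕ.+-assoc (toℕ i) (toℕ j) (toℕ k)) ⟩
    (toℕ i + (toℕ j + toℕ k)) % l          ≡⟨ cong (_% l) (ℕ.+-comm (toℕ i) _) ⟩
    ((toℕ j + toℕ k) + toℕ i) % l          ≡⟨ [m%l+n]%l≡[m+n]%l (toℕ j + toℕ k) (toℕ i) ⟨
    ((toℕ j + toℕ k) % l + toℕ i) % l      ≡⟨ cong (λ z → (z + toℕ i) % l) (toℕ-mod _) ⟨
    (toℕ (j ⊕ k) + toℕ i) % l              ≡⟨ cong (_% l) (ℕ.+-comm (toℕ (j ⊕ k)) (toℕ i)) ⟩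
    (toℕ i + toℕ (j ⊕ k)) % l              ∎)
    where open ≡-Reasoning

  ⊕-identityˡ : ∀ i → 0F ⊕ i ≡ i
  ⊕-identityˡ i = toℕ-injective (trans (toℕ-mod _) (trans (cong (λ z → (z + toℕ i) % l) toℕ-0F) (m<n⇒m%n≡m (toℕ<n i))))

  ⊕-inverseˡ : ∀ i → ⊖ i ⊕ i ≡ 0F
  ⊕-inverseˡ i = mod-cong (begin
    (toℕ (⊖ i) + toℕ i) % l          ≡⟨ cong (λ z → (z + toℕ i) % l) (toℕ-mod _) ⟩
    ((l ∸ toℕ i) % l + toℕ i) % l    ≡⟨ [m%l+n]%l≡[m+n]%l (l ∸ toℕ i) (toℕ i) ⟩
    (l ∸ toℕ i + toℕ i) % l          ≡⟨ cong (_% l) (ℕ.m∸n+n≡m (ℕ.<⇒≤ (toℕ<n i))) ⟩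
    l % l                            ≡⟨ n%n≡0 l ⟩
    0                                ≡⟨ m<n⇒m%n≡m (ℕ.>-nonZero⁻¹ l) ⟨
    0 % l                            ∎)
    where open ≡-Reasoning

  ⊕-identityʳ : ∀ i → i ⊕ 0F ≡ i
  ⊕-identityʳ i = trans (⊕-comm i 0F) (⊕-identityˡ i)

  ⊕-inverseʳ : ∀ i → i ⊕ ⊖ i ≡ 0F
  ⊕-inverseʳ i = trans (⊕-comm i (⊖ i)) (⊕-inverseˡ i)

  ⊕-isGroup : IsGroup _≡_ _⊕_ 0F ⊖_
  ⊕-isGroup = record
    { isMonoid = record
      { isSemigroup = record { isMagma = record { isEquivalence = isEquivalence ; ∙-cong = cong₂ _⊕_ } ; assoc = ⊕-assoc }
      ; identity = ⊕-identityˡ , ⊕-identityʳ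
      }
    ; inverse = ⊕-inverseˡ , ⊕-inverseʳ
    ; ⁻¹-cong = cong ⊖_
    }

  ⊕-group : Group _ _
  ⊕-group = record { isGroup = ⊕-isGroup }

module SchemeGroup (F : FiniteField) (q : ℕ) (σ : FiniteField.Carrier F) (l : ℕ) {{_ : NonZero l}}
                   (A : Fin l → FiniteField.Carrier F → Bool)
                   (τˡ≡1 : FiniteField.pow F (Scheme.τ F q σ l A) l ≡ FiniteField.1# F) where
  open FieldFacts F
  open Scheme F q σ l A
  open Cyclic l

  τ^ : Fin l → Carrier
  τ^ i = pow τ (toℕ i)

  τ^-0F : τ^ 0F ≡ 1#
  τ^-0F = cong (pow τ) toℕ-0F

  elemsG-complete : ∀ g → g ∈ elemsG
  elemsG-complete (a , i) = ∈-cartesianProduct⁺ (elems-complete a) (∈-allFin i)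

  elemsG-unique : Unique elemsG
  elemsG-unique = Unique.cartesianProduct⁺ elems-unique (Unique.allFin⁺ l)

  module G = Enumerated elemsG elemsG-complete elemsG-unique

  τ^-⊕ : ∀ i j → τ^ (i ⊕ j) ≡ τ^ i * τ^ j
  τ^-⊕ i j = trans (cong (pow τ) (toℕ-mod _)) (trans (pow-mod τˡ≡1 _) (pow-+ τ (toℕ i) (toℕ j)))

  τ^-inverseʳ : ∀ j → τ^ j * τ^ (⊖ j) ≡ 1#
  τ^-inverseʳ j = trans (sym (τ^-⊕ j (⊖ j))) (trans (cong τ^ (⊕-inverseʳ j)) τ^-0F)

  τ^-inverseˡ : ∀ j → τ^ (⊖ j) * τ^ j ≡ 1#
  τ^-inverseˡ j = trans (*-comm _ _) (τ^-inverseʳ j)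

  infix 30 _⁻¹
  _⁻¹ : G → G
  (a , i) ⁻¹ = - (τ^ (⊖ i) * a) , ⊖ i

  ·-isGroup : IsGroup _≡_ _·_ 1G _⁻¹
  ·-isGroup = record
    { isMonoid = record
      { isSemigroup = record { isMagma = record { isEquivalence = isEquivalence ; ∙-cong = cong₂ _·_ } ; assoc = ·-assoc }
      ; identity = ·-identityˡ , ·-identityʳ
      }
    ; inverse = ·-inverseˡ , ·-inverseʳ
    ; ⁻¹-cong = cong _⁻¹
    }
    where
    ·-assoc : ∀ g h k → (g · h) · k ≡ g · (h · k)
    ·-assoc (a , i) (b , j) (c , k) = cong₂ _,_ (begin
      (a + τ^ i * b) + τ^ (i ⊕ j) * c        ≡⟨ cong (λ z → (a + τ^ i * b) + z * c) (τ^-⊕ i j) ⟩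
      (a + τ^ i * b) + (τ^ i * τ^ j) * c     ≡⟨ +-assoc a _ _ ⟩
      a + (τ^ i * b + (τ^ i * τ^ j) * c)     ≡⟨ cong (λ z → a + (τ^ i * b + z)) (*-assoc (τ^ i) (τ^ j) c) ⟩
      a + (τ^ i * b + τ^ i * (τ^ j * c))     ≡⟨ cong (a +_) (distribˡ (τ^ i) b _) ⟨
      a + τ^ i * (b + τ^ j * c)              ∎) (⊕-assoc i j k)
      where open ≡-Reasoning
    ·-identityˡ : ∀ g → 1G · g ≡ g
    ·-identityˡ (b , j) = cong₂ _,_ (trans (+-identityˡ _) (trans (cong (_* b) τ^-0F) (*-identityˡ b))) (⊕-identityˡ j)
    ·-identityʳ : ∀ g → g · 1G ≡ g
    ·-identityʳ (a , i) = cong₂ _,_ (trans (cong (a +_) (zeroʳ _)) (+-identityʳ a)) (⊕-identityʳ i)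
    ·-inverseˡ : ∀ g → g ⁻¹ · g ≡ 1G
    ·-inverseˡ (a , i) = cong₂ _,_ (-‿inverseˡ _) (⊕-inverseˡ i)
    ·-inverseʳ : ∀ g → g · g ⁻¹ ≡ 1G
    ·-inverseʳ (a , i) = cong₂ _,_ (begin
      a + τ^ i * - (τ^ (⊖ i) * a)     ≡⟨ cong (a +_) (-‿distribʳ-* (τ^ i) _) ⟨
      a - τ^ i * (τ^ (⊖ i) * a)       ≡⟨ cong (λ u → a - u) (st≡1⇒s[ty]≡y (τ^-inverseʳ i) a) ⟩
      a - a                           ≡⟨ -‿inverseʳ a ⟩
      0#                              ∎) (⊕-inverseʳ i)
      where open ≡-Reasoning

  G-group : Group _ _
  G-group = record { isGroup = ·-isGroup }

  open GroupProperties G-group using (//-rightDividesˡ; //-rightDividesʳ; x≈z//y; ⁻¹-anti-homo-∙)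
  open IsGroup ·-isGroup using () renaming (assoc to ·-assoc)

  inS-char : ∀ X g h → inS X g h ≡ X (h · g ⁻¹)
  inS-char X g h = ≡true⇔⇒≡ (mk⇔ to from)
    where
    p : G → Bool
    p x = X x ∧ does (h ≟G (x · g))
    to : inS X g h ≡ true → X (h · g ⁻¹) ≡ true
    to inS≡true with any≡true⇒ elemsG inS≡true
    ... | x , px with Equivalence.to ∧≡true⇔ px
    ...   | Xx , h≟xg = subst (λ z → X z ≡ true) (x≈z//y x g h (sym (Equivalence.to (does≡true⇔ (h ≟G (x · g))) h≟xg))) Xx
    from : X (h · g ⁻¹) ≡ true → inS X g h ≡ true
    from X[hg⁻¹] = ∈⇒any≡true (elemsG-complete (h · g ⁻¹))
      (Equivalence.from ∧≡true⇔ (X[hg⁻¹] , Equivalence.from (does≡true⇔ (h ≟G _)) (sym (//-rightDividesˡ g h))))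

  c-char : ∀ X Y x y → c X Y x y ≡ G.# (λ a → X a ∧ Y ((y · x ⁻¹) · a ⁻¹))
  c-char X Y x y = begin
    c X Y x y                                            ≡⟨ G.#-cong (λ z → cong₂ _∧_ (inS-char X x z) (inS-char Y z y)) ⟩
    G.# (λ z → X (z · x ⁻¹) ∧ Y (y · z ⁻¹))
      ≡⟨ G.#-bijection (λ z → X (z · x ⁻¹) ∧ Y (y · z ⁻¹)) (_· x) (_· x ⁻¹) (//-rightDividesʳ x) (//-rightDividesˡ x) ⟨
    G.# (λ a → X ((a · x) · x ⁻¹) ∧ Y (y · (a · x) ⁻¹))  ≡⟨ G.#-cong (λ a → cong₂ _∧_ (cong X (//-rightDividesʳ x a)) (cong Y (begin
        y · (a · x) ⁻¹        ≡⟨ cong (y ·_) (⁻¹-anti-homo-∙ a x) ⟩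
        y · (x ⁻¹ · a ⁻¹)     ≡⟨ ·-assoc y (x ⁻¹) (a ⁻¹) ⟨
        (y · x ⁻¹) · a ⁻¹     ∎))) ⟩
    G.# (λ a → X a ∧ Y ((y · x ⁻¹) · a ⁻¹))              ∎
    where open ≡-Reasoning

module CayleyScheme (F : FiniteField) {q r : ℕ} (q≥2 : 2 ≤ q) (r≥2 : 2 ≤ r) (size≡q^r : FiniteField.size F ≡ q ^ r)
               {σ : FiniteField.Carrier F} (generator : IsGenerator F σ)
               (l : ℕ) {{_ : NonZero l}} (l*[q∸1]≡q^r∸1 : l ℕ.* (q ∸ 1) ≡ q ^ r ∸ 1)
               (A : Fin l → FiniteField.Carrier F → Bool) (ordering : IsOrderingOfMaximalSubgroups F q r l A) where
  open FieldFacts F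
  open GeneratorOrder F generator
  open Scheme F q σ l A
  open Cyclic l

  module Indices = Enumerated (allFin l) ∈-allFin (Unique.allFin⁺ l)

  l*[q∸1]≡N : l ℕ.* (q ∸ 1) ≡ N
  l*[q∸1]≡N = trans l*[q∸1]≡q^r∸1 (cong (_∸ 1) (sym size≡q^r))

  τˡ≡1 : pow τ l ≡ 1#
  τˡ≡1 = trans (sym (pow-* σ (q ∸ 1) l)) (trans (cong (pow σ) (trans (ℕ.*-comm (q ∸ 1) l) l*[q∸1]≡N)) pow-σ-N)

  open SchemeGroup F q σ l A τˡ≡1

  open Subfield {q} {l} (ℕ.<⇒≤ q≥2) l*[q∸1]≡N
  open Hyperplanes F subfield-unique subfield-length subfield-fixed

  ^-pred : ∀ {n} → 1 ≤ n → q ^ (n ∸ 1) ℕ.* q ≡ q ^ n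
  ^-pred {suc n} _ = ℕ.*-comm (q ^ n) q

  Q : ℕ
  Q = q ^ (r ∸ 1)

  Q*q≡size : Q ℕ.* q ≡ size
  Q*q≡size = trans (^-pred (ℕ.≤-trans (ℕ.s≤s ℕ.z≤n) r≥2)) (sym size≡q^r)

  Q≡q^[r∸2]*q : Q ≡ q ^ (r ∸ 2) ℕ.* q
  Q≡q^[r∸2]*q = trans (sym (^-pred (ℕ.∸-monoˡ-≤ 1 r≥2))) (cong (λ e → q ^ e ℕ.* q) (ℕ.∸-+-assoc r 1 1))

  Q≥2 : 2 ≤ Q
  Q≥2 = ℕ.≤-trans q≥2 (ℕ.≤-trans (ℕ.≤-reflexive (sym (ℕ.*-identityʳ q))) (ℕ.^-monoʳ-≤ q (ℕ.∸-monoˡ-≤ 1 r≥2)))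
    where instance _ = ℕ.>-nonZero (ℕ.≤-trans (ℕ.s≤s ℕ.z≤n) q≥2)

  l*[q∸1]≡Q*q∸1 : l ℕ.* (q ∸ 1) ≡ Q ℕ.* q ∸ 1
  l*[q∸1]≡Q*q∸1 = trans l*[q∸1]≡q^r∸1 (cong (_∸ 1) (trans (sym size≡q^r) (sym Q*q≡size)))

  A-subspace : ∀ i → IsFqSubspace F q (A i)
  A-subspace i = proj₁ (proj₁ ordering i)

  #A : ∀ i → # (A i) ≡ Q
  #A i = proj₂ (proj₁ ordering i)

  A-injective : ∀ {i j} → A i ≗ A j → i ≡ j
  A-injective = proj₁ (proj₂ ordering) _ _

  #A*q≡size : ∀ i → # (A i) ℕ.* q ≡ size
  #A*q≡size i = trans (cong (ℕ._* q) (#A i)) Q*q≡size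

  open IsGroup ·-isGroup using () renaming (inverseʳ to ·-inverseʳ)

  isZeroFin≡true⇔ : ∀ i → isZeroFin i ≡ true ⇔ i ≡ 0F
  isZeroFin≡true⇔ i = mk⇔ (λ Zi → toℕ-injective (trans (Equivalence.to (does≡true⇔ (toℕ i ℕ.≟ 0)) Zi) (sym toℕ-0F)))
                          (λ i≡0F → Equivalence.from (does≡true⇔ (toℕ i ℕ.≟ 0)) (trans (cong toℕ i≡0F) toℕ-0F))

  nonzero-index : ∀ {i} b → not (isZeroFin i) ∧ b ≡ true → i ≢ 0F
  nonzero-index {i} b ¬Zi∧b i≡0F =
    not-¬ (Equivalence.from (isZeroFin≡true⇔ i) i≡0F) (not-injective (proj₁ (Equivalence.to ∧≡true⇔ ¬Zi∧b)))

  #zero-indices : Indices.# isZeroFin ≡ 1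
  #zero-indices = Indices.#-single isZeroFin 0F isZeroFin≡true⇔

  #nonzero-indices : Indices.# (not ∘ isZeroFin) ≡ l ∸ 1
  #nonzero-indices = trans (Indices.#-remove-single (λ _ → true) isZeroFin #zero-indices)
                           (cong (_∸ 1) (trans Indices.#-true (length-tabulate {n = l} (λ i → i))))

  #admissible-indices : ∀ {k} → k ≢ 0F → Indices.# (λ i → not (isZeroFin i) ∧ not (isZeroFin (k ⊕ ⊖ i))) ≡ l ∸ 2
  #admissible-indices {k} k≢0F = begin
    Indices.# (λ i → not (isZeroFin i) ∧ not (isZeroFin (k ⊕ ⊖ i)))
      ≡⟨ Indices.#-cong (λ i → cong (λ b → not (isZeroFin i) ∧ not b) (isZero[k⊕⊖i]≡i≟k i)) ⟩
    Indices.# (λ i → not (isZeroFin i) ∧ not (does (i Fin.≟ k)))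
      ≡⟨ Indices.#-remove-single (not ∘ isZeroFin) (λ i → does (i Fin.≟ k)) #k ⟩
    Indices.# (not ∘ isZeroFin) ∸ 1
      ≡⟨ cong (_∸ 1) #nonzero-indices ⟩
    l ∸ 1 ∸ 1
      ≡⟨ ℕ.∸-+-assoc l 1 1 ⟩
    l ∸ 2 ∎
    where
    open ≡-Reasoning
    open GroupProperties ⊕-group using (x∙y⁻¹≈ε⇒x≈y)
    isZero[k⊕⊖i]≡i≟k : ∀ i → isZeroFin (k ⊕ ⊖ i) ≡ does (i Fin.≟ k)
    isZero[k⊕⊖i]≡i≟k i = ≡true⇔⇒≡ (mk⇔
      (λ ZJ → Equivalence.from (does≡true⇔ (i Fin.≟ k)) (sym (x∙y⁻¹≈ε⇒x≈y k i (Equivalence.to (isZeroFin≡true⇔ _) ZJ))))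
      (λ E → Equivalence.from (isZeroFin≡true⇔ _)
               (subst (λ j → k ⊕ ⊖ j ≡ 0F) (sym (Equivalence.to (does≡true⇔ (i Fin.≟ k)) E)) (⊕-inverseʳ k))))
    #k : Indices.# (λ i → not (isZeroFin i) ∧ does (i Fin.≟ k)) ≡ 1
    #k = Indices.#-single _ k λ i → mk⇔
      (λ ¬Zi∧E → Equivalence.to (does≡true⇔ (i Fin.≟ k)) (proj₂ (Equivalence.to ∧≡true⇔ ¬Zi∧E)))
      (λ { refl → Equivalence.from ∧≡true⇔ (cong not (¬-not (k≢0F ∘ Equivalence.to (isZeroFin≡true⇔ k))) ,
                                            Equivalence.from (does≡true⇔ (k Fin.≟ k)) refl) })

  card-by-index : (R : Fin l → Bool) (S : Fin l → Carrier → Bool) {m : ℕ} → (∀ i → # (S i) ≡ m) →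
                  G.# (λ g → R (proj₂ g) ∧ S (proj₂ g) (proj₁ g)) ≡ Indices.# R ℕ.* m
  card-by-index R S #S≡m = count-by-index elems-unique (Unique.allFin⁺ l) _ R _
    (λ i → trans (count-∧ˡ (R i) (S i) elems) (cong (if R i then_else 0) (#S≡m i)))

  #A∖0 : ∀ i → # (λ a → A i a ∧ not (does (a ≟ 0#))) ≡ Q ∸ 1
  #A∖0 i = trans (#-remove-single (A i) (λ a → does (a ≟ 0#)) #A∩0) (cong (_∸ 1) (#A i))
    where
    #A∩0 : # (λ a → A i a ∧ does (a ≟ 0#)) ≡ 1
    #A∩0 = #-single _ 0# λ a → mk⇔
      (λ A∩0 → Equivalence.to (does≡true⇔ (a ≟ 0#)) (proj₂ (Equivalence.to ∧≡true⇔ A∩0)))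
      (λ { refl → Equivalence.from ∧≡true⇔ (Subspace.0∈ (A-subspace i) , Equivalence.from (does≡true⇔ (0# ≟ 0#)) refl) })

  #∁A : ∀ i → # (not ∘ A i) ≡ Q ℕ.* q ∸ Q
  #∁A i = begin
    # (not ∘ A i)                      ≡⟨ ℕ.m+n∸m≡n Q _ ⟨
    Q ℕ.+ # (not ∘ A i) ∸ Q            ≡⟨ cong (λ n → n ℕ.+ # (not ∘ A i) ∸ Q) (#A i) ⟨
    # (A i) ℕ.+ # (not ∘ A i) ∸ Q      ≡⟨ cong (_∸ Q) (trans (#-complement (A i)) (sym Q*q≡size)) ⟩
    Q ℕ.* q ∸ Q                        ∎
    where open ≡-Reasoning

  n₁≡ : card X₁ ≡ Q ∸ 1
  n₁≡ = trans (card-by-index isZeroFin (λ i a → A i a ∧ not (does (a ≟ 0#))) #A∖0)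
              (trans (cong (ℕ._* (Q ∸ 1)) #zero-indices) (ℕ.*-identityˡ _))

  n₂≡ : card X₂ ≡ Q ℕ.* q ∸ Q
  n₂≡ = trans (card-by-index isZeroFin (λ i a → not (A i a)) #∁A)
              (trans (cong (ℕ._* _) #zero-indices) (ℕ.*-identityˡ _))

  n₃≡ : card X₃ ≡ (l ∸ 1) ℕ.* Q
  n₃≡ = trans (card-by-index (not ∘ isZeroFin) A #A) (cong (ℕ._* Q) #nonzero-indices)

  n₄≡ : card X₄ ≡ (l ∸ 1) ℕ.* (Q ℕ.* q ∸ Q)
  n₄≡ = trans (card-by-index (not ∘ isZeroFin) (λ i a → not (A i a)) #∁A) (cong (ℕ._* _) #nonzero-indices)

  module _ (inverse-closed : InverseClosed W) where

    -- (τʲ y , j)⁻¹ = (- y , ⊖ j), so inverse-closedness of W gives A (⊖ j) ⊆ τ⁻ʲ A j; both have Q elements.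
    A[⊖j]≡A[j]∘τʲ : ∀ j → A (⊖ j) ≗ (λ y → A j (τ^ j * y))
    A[⊖j]≡A[j]∘τʲ j y = ≡true⇔⇒≡ (mk⇔ (A[⊖j]⊆A[j]∘τʲ y) (⊆∧#≤⇒⊇ A[⊖j]⊆A[j]∘τʲ same-size y))
      where
      A[⊖j]⊆A[j]∘τʲ : ∀ y → A (⊖ j) y ≡ true → A j (τ^ j * y) ≡ true
      A[⊖j]⊆A[j]∘τʲ y A[⊖j]y with A j (τ^ j * y) in A[j]τʲy
      ... | true  = refl
      ... | false = ⊥-elim (not-¬ A[⊖j][-y] (subst (λ z → A (⊖ j) z ≡ true) (cong -_ (sym (st≡1⇒s[ty]≡y (τ^-inverseˡ j) y)))
                                                 (Subspace.-‿closed (A-subspace (⊖ j)) A[⊖j]y)))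
        where
        A[⊖j][-y] : A (⊖ j) (- (τ^ (⊖ j) * (τ^ j * y))) ≡ false
        A[⊖j][-y] = not-injective (inverse-closed (τ^ j * y , j) _ (cong not A[j]τʲy) (·-inverseʳ _))
      same-size : # (λ y → A j (τ^ j * y)) ≤ # (A (⊖ j))
      same-size = ℕ.≤-reflexive (trans (#-scale (A j) (τ^-inverseʳ j)) (trans (#A j) (sym (#A (⊖ j)))))

    -- A J (z - τᴶ a) = A (⊖ J) (τ^(⊖ J) z - a), and A i ≠ A (⊖ J) because k ≠ 0.
    coset-fibre : ∀ z {k} → k ≢ 0F → ∀ i →
                  count (λ a → A i a ∧ A (k ⊕ ⊖ i) (z + τ^ k * - (τ^ (⊖ i) * a))) elems ≡ q ^ (r ∸ 2)
    coset-fibre z {k} k≢0F i = ℕ.*-cancelʳ-≡ _ _ q (begin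
      count (λ a → A i a ∧ A J (z + τ^ k * - (τ^ (⊖ i) * a))) elems ℕ.* q
        ≡⟨ cong (ℕ._* q) (#-cong λ a → cong (A i a ∧_) (trans (cong (A J) (first-component a)) (sym (A[⊖j]≡A[j]∘τʲ J _))))
         ⟩
      # (λ a → A i a ∧ A (⊖ J) (τ^ (⊖ J) * z - a)) ℕ.* q
        ≡⟨ coset-intersection (A-subspace i) (A-subspace (⊖ J)) (#A*q≡size i) (trans (#A i) (sym (#A (⊖ J)))) A[i]≢A[⊖J] _
         ⟩
      # (A (⊖ J))
        ≡⟨ #A (⊖ J) ⟩
      Q
        ≡⟨ Q≡q^[r∸2]*q ⟩
      q ^ (r ∸ 2) ℕ.* q ∎)
      where
      open ≡-Reasoning
      J = k ⊕ ⊖ i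
      instance _ = ℕ.>-nonZero (ℕ.≤-trans (ℕ.s≤s ℕ.z≤n) q≥2)
      first-component : ∀ a → z + τ^ k * - (τ^ (⊖ i) * a) ≡ τ^ J * (τ^ (⊖ J) * z - a)
      first-component a = begin
        z + τ^ k * - (τ^ (⊖ i) * a)                  ≡⟨ cong (z +_) (-‿distribʳ-* _ _) ⟨
        z - τ^ k * (τ^ (⊖ i) * a)                    ≡⟨ cong (λ u → z - u) (*-assoc _ _ a) ⟨
        z - (τ^ k * τ^ (⊖ i)) * a                    ≡⟨ cong (λ u → z - u * a) (τ^-⊕ k (⊖ i)) ⟨
        z - τ^ J * a                                 ≡⟨ cong (_- τ^ J * a) (st≡1⇒s[ty]≡y (τ^-inverseʳ J) z) ⟨
        τ^ J * (τ^ (⊖ J) * z) - τ^ J * a             ≡⟨ cong (τ^ J * (τ^ (⊖ J) * z) +_) (-‿distribʳ-* _ _) ⟩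
        τ^ J * (τ^ (⊖ J) * z) + τ^ J * - a           ≡⟨ distribˡ (τ^ J) _ _ ⟨
        τ^ J * (τ^ (⊖ J) * z - a)                    ∎
      A[i]≢A[⊖J] : ¬ (A i ≗ A (⊖ J))
      A[i]≢A[⊖J] A[i]≡A[⊖J] = k≢0F (begin
        k              ≡⟨ //-rightDividesˡ i k ⟨
        J ⊕ i          ≡⟨ cong (J ⊕_) (A-injective A[i]≡A[⊖J]) ⟩
        J ⊕ ⊖ J        ≡⟨ ⊕-inverseʳ J ⟩
        0F             ∎)
        where open GroupProperties ⊕-group using (//-rightDividesˡ)

    #[X₃∩X₃⁻¹g] : ∀ z {k} → k ≢ 0F → G.# (λ a → X₃ a ∧ X₃ ((z , k) · a ⁻¹)) ≡ (l ∸ 2) ℕ.* q ^ (r ∸ 2)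
    #[X₃∩X₃⁻¹g] z {k} k≢0F = trans (count-by-index elems-unique (Unique.allFin⁺ l) _ admissible _ fibre)
                                   (cong (ℕ._* q ^ (r ∸ 2)) (#admissible-indices k≢0F))
      where
      admissible : Fin l → Bool
      admissible i = not (isZeroFin i) ∧ not (isZeroFin (k ⊕ ⊖ i))
      fibre : ∀ i → count (λ a → X₃ (a , i) ∧ X₃ ((z , k) · (a , i) ⁻¹)) elems ≡ (if admissible i then q ^ (r ∸ 2) else 0)
      fibre i = trans (#-cong λ a → ∧-interchange (not (isZeroFin i)) (A i a) (not (isZeroFin (k ⊕ ⊖ i))) _)
                      (trans (count-∧ˡ (admissible i) _ elems) (cong (if admissible i then_else 0) (coset-fibre z k≢0F i)))

    intersection-number : ∀ x y → proj₂ (y · x ⁻¹) ≢ 0F → c X₃ X₃ x y ≡ (l ∸ 2) ℕ.* q ^ (r ∸ 2)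
    intersection-number x y k≢0F = trans (c-char X₃ X₃ x y) (#[X₃∩X₃⁻¹g] (proj₁ (y · x ⁻¹)) k≢0F)

    c₃₃-constant : ∀ x y x′ y′ → inS X₃ x y ≡ true → inS X₄ x′ y′ ≡ true → c X₃ X₃ x y ≡ c X₃ X₃ x′ y′
    c₃₃-constant x y x′ y′ xy∈s₃ x′y′∈s₄ = trans
      (intersection-number x y (nonzero-index _ (trans (sym (inS-char X₃ x y)) xy∈s₃)))
      (sym (intersection-number x′ y′ (nonzero-index _ (trans (sym (inS-char X₄ x′ y′)) x′y′∈s₄))))

module FractionArithmetic where
  open import Data.Nat using (_+_; _*_; _∸_; _≤_)
  open import Data.Integer using (+_)

  frac≡frac⇔ : ∀ a b c d .{{_ : NonZero b}} .{{_ : NonZero d}} → frac a b ≡ frac c d ⇔ a * d ≡ c * b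
  frac≡frac⇔ a (suc b) c (suc d) = mk⇔ to from
    where
    to : frac a (suc b) ≡ frac c (suc d) → a * suc d ≡ c * suc b
    to eq with ℚᵘ.≃-trans (ℚᵘ.≃-sym (ℚ.toℚᵘ-fromℚᵘ (ℚᵘ.mkℚᵘ (+ a) b)))
                          (ℚᵘ.≃-trans (ℚ.toℚᵘ-cong eq) (ℚ.toℚᵘ-fromℚᵘ (ℚᵘ.mkℚᵘ (+ c) d)))
    ... | ℚᵘ.*≡* cross = ℤ.+-injective (trans (ℤ.pos-* a (suc d)) (trans cross (sym (ℤ.pos-* c (suc b)))))
    from : a * suc d ≡ c * suc b → frac a (suc b) ≡ frac c (suc d)
    from cross = ℚ.fromℚᵘ-cong {ℚᵘ.mkℚᵘ (+ a) b} {ℚᵘ.mkℚᵘ (+ c) d}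
                   (ℚᵘ.*≡* (trans (sym (ℤ.pos-* a (suc d))) (trans (cong +_ cross) (ℤ.pos-* c (suc b)))))

  frac-+ : ∀ a b c d .{{_ : NonZero b}} .{{_ : NonZero d}} → frac a b +ℚ frac c d ≡ frac (a * d + c * b) (b * d)
  frac-+ a (suc b) c (suc d) = ℚ.toℚᵘ-injective (begin
    toℚᵘ (frac a (suc b) +ℚ frac c (suc d))                 ≈⟨ ℚ.toℚᵘ-homo-+ (frac a (suc b)) (frac c (suc d)) ⟩
    toℚᵘ (frac a (suc b)) ℚᵘ.+ toℚᵘ (frac c (suc d))      ≈⟨ ℚᵘ.+-cong (ℚ.toℚᵘ-fromℚᵘ (ℚᵘ.mkℚᵘ (+ a) b)) (ℚ.toℚᵘ-fromℚᵘ (ℚᵘ.mkℚᵘ (+ c) d)) ⟩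
    ℚᵘ.mkℚᵘ (+ a) b ℚᵘ.+ ℚᵘ.mkℚᵘ (+ c) d                    ≈⟨ ℚᵘ.*≡* (cong (ℤ._* + (suc b * suc d)) (sym numerator)) ⟩
    ℚᵘ.mkℚᵘ (+ (a * suc d + c * suc b)) (ℕ.pred (suc b * suc d)) ≈⟨ ℚ.toℚᵘ-fromℚᵘ _ ⟨
    toℚᵘ (frac (a * suc d + c * suc b) (suc b * suc d))     ∎)
    where
    open ℚᵘ.≃-Reasoning
    numerator : + (a * suc d + c * suc b) ≡ + a ℤ.* + suc d ℤ.+ + c ℤ.* + suc b
    numerator = trans (ℤ.pos-+ (a * suc d) _) (cong₂ ℤ._+_ (ℤ.pos-* a (suc d)) (ℤ.pos-* c (suc b)))

  -≡⇔≡+ : ∀ x y z → x -ℚ y ≡ z ⇔ x ≡ z +ℚ y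
  -≡⇔≡+ x y z = mk⇔ (λ x-y≡z → trans (sym (//-rightDividesˡ y x)) (cong (_+ℚ y) x-y≡z))
                     (λ x≡z+y → sym (x≈z//y z y x (sym x≡z+y)))
    where open GroupProperties ℚ.+-0-group using (//-rightDividesˡ; x≈z//y)

  ≡⇔≡ : {A : Set} {x x′ y y′ : A} → x ≡ x′ → y ≡ y′ → (x ≡ y) ⇔ (x′ ≡ y′)
  ≡⇔≡ refl refl = mk⇔ (λ e → e) (λ e → e)

  frac-x-a/b≡1⇔ : ∀ x a b .{{_ : NonZero b}} → (frac x 1 -ℚ frac a b ≡ 1ℚ) ⇔ (x * b ≡ b + a)
  frac-x-a/b≡1⇔ x a b =
    ⇔-trans (-≡⇔≡+ (frac x 1) (frac a b) 1ℚ)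
    (⇔-trans (≡⇔≡ refl (frac-+ 1 1 a b))
    (⇔-trans (frac≡frac⇔ x 1 (1 * b + a * 1) (1 * b) {{_}} {{ℕ.m*n≢0 1 b}})
             (≡⇔≡ (cong (x *_) (ℕ.*-identityˡ b)) (trans (ℕ.*-identityʳ _) (cong₂ _+_ (ℕ.*-identityˡ b) (ℕ.*-identityʳ a))))))

  n*n≡n+2⇔n≡2 : ∀ n → n * n ≡ n + 2 ⇔ n ≡ 2
  n*n≡n+2⇔n≡2 n = mk⇔ (to n) (λ { refl → refl })
    where
    to : ∀ n → n * n ≡ n + 2 → n ≡ 2
    to 2 _ = refl
    to (suc (suc (suc k))) eq with ℕ.+-cancelˡ-≡ k (suc (suc (suc _))) 2 (cong (ℕ.pred ∘ ℕ.pred ∘ ℕ.pred) eq)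
    ... | ()

  -- n₁, Q = n₁ + 1, P = q - 1 and L = l - 1 as successors, so that every denominator is visibly nonzero.
  module Ratios (n p m : ℕ) where
    n₁ Q P L : ℕ
    n₁ = suc n
    Q  = suc n₁
    P  = suc p
    L  = suc m

    reciprocal-identity : L * P ≡ n₁ * suc P → frac 1 (L * Q) +ℚ frac 1 (L * (Q * P)) ≡ frac 1 n₁ -ℚ frac 1 (n₁ + 1)
    reciprocal-identity LP≡n₁[P+1] = begin
      frac 1 (L * Q) +ℚ frac 1 (L * (Q * P))
        ≡⟨ frac-+ 1 (L * Q) 1 (L * (Q * P)) ⟩
      frac (1 * (L * (Q * P)) + 1 * (L * Q)) (L * Q * (L * (Q * P)))
        ≡⟨ Equivalence.from (frac≡frac⇔ (1 * (L * (Q * P)) + 1 * (L * Q)) (L * Q * (L * (Q * P))) (suc P) (L * (Q * P)))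
                            (sum-numerator L Q P) ⟩
      frac (suc P) (L * (Q * P))
        ≡⟨ Equivalence.from (frac≡frac⇔ (suc P) (L * (Q * P)) 1 (n₁ * Q)) (begin
             suc P * (n₁ * Q)   ≡⟨ rearrange₁ P n₁ Q ⟩
             Q * (n₁ * suc P)   ≡⟨ cong (Q *_) LP≡n₁[P+1] ⟨
             Q * (L * P)        ≡⟨ rearrange₂ Q L P ⟩
             1 * (L * (Q * P))  ∎) ⟩
      frac 1 (n₁ * Q)
        ≡⟨ Equivalence.from (-≡⇔≡+ (frac 1 n₁) (frac 1 (n₁ + 1)) (frac 1 (n₁ * Q)))
             (trans (Equivalence.from (frac≡frac⇔ 1 n₁ (1 * (n₁ + 1) + 1 * (n₁ * Q)) (n₁ * Q * (n₁ + 1))) (telescope n₁))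
                    (sym (frac-+ 1 (n₁ * Q) 1 (n₁ + 1)))) ⟨
      frac 1 n₁ -ℚ frac 1 (n₁ + 1)
        ∎
      where
      open ≡-Reasoning
      sum-numerator : ∀ a b c → (1 * (a * (b * c)) + 1 * (a * b)) * (a * (b * c)) ≡ suc c * (a * b * (a * (b * c)))
      sum-numerator = solve-∀
      rearrange₁ : ∀ a b c → suc a * (b * c) ≡ c * (b * suc a)
      rearrange₁ = solve-∀
      rearrange₂ : ∀ a b c → a * (b * c) ≡ 1 * (b * (a * c))
      rearrange₂ = solve-∀
      telescope : ∀ k → 1 * (k * (1 + k) * (k + 1)) ≡ (1 * (k + 1) + 1 * (k * (1 + k))) * k
      telescope = solve-∀

    n₂/[n₁+1]≡P : frac (Q * P) (n₁ + 1) ≡ frac P 1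
    n₂/[n₁+1]≡P = Equivalence.from (frac≡frac⇔ (Q * P) (n₁ + 1) P 1) (shape n₁ P)
      where
      shape : ∀ a b → suc a * b * 1 ≡ b * (a + 1)
      shape = solve-∀

    ratio-3 : (frac (Q * P) (n₁ + 1) -ℚ frac (2 * (L * Q)) (L * (Q * P)) ≡ 1ℚ) ⇔ (suc P ≡ 3)
    ratio-3 =
      ⇔-trans (≡⇔≡ (cong₂ _-ℚ_ n₂/[n₁+1]≡P 2n₃/n₄≡2/P) refl)
      (⇔-trans (frac-x-a/b≡1⇔ P 2 P)
      (⇔-trans (n*n≡n+2⇔n≡2 P) (mk⇔ (cong suc) ℕ.suc-injective)))
      where
      shape : ∀ a b c → 2 * (a * b) * c ≡ 2 * (a * (b * c))
      shape = solve-∀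
      2n₃/n₄≡2/P : frac (2 * (L * Q)) (L * (Q * P)) ≡ frac 2 P
      2n₃/n₄≡2/P = Equivalence.from (frac≡frac⇔ (2 * (L * Q)) (L * (Q * P)) 2 P) (shape L Q P)

    ratio-4 : frac (Q * P) (n₁ + 1) -ℚ frac (2 * (L * (Q * P))) (L * Q) ≢ 1ℚ
    ratio-4 eq = ℕ.m≢1+m+n P (trans (sym (ℕ.*-identityʳ P))
      (Equivalence.to (frac-x-a/b≡1⇔ P (2 * P) 1) (trans (sym (cong₂ _-ℚ_ n₂/[n₁+1]≡P 2n₄/n₃≡2P)) eq)))
      where
      shape : ∀ a b c → 2 * (a * (b * c)) * 1 ≡ 2 * c * (a * b)
      shape = solve-∀
      2n₄/n₃≡2P : frac (2 * (L * (Q * P))) (L * Q) ≡ frac (2 * P) 1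
      2n₄/n₃≡2P = Equivalence.from (frac≡frac⇔ (2 * (L * (Q * P))) (L * Q) (2 * P) 1) (shape L Q P)

    valency-identities : ∀ {n₁′ n₂ n₃ n₄ q : ℕ} → n₁′ ≡ n₁ → n₂ ≡ Q * P → n₃ ≡ L * Q → n₄ ≡ L * (Q * P) → q ≡ suc P →
                         L * P ≡ n₁ * suc P →
                         (frac 1 n₃ +ℚ frac 1 n₄ ≡ frac 1 n₁′ -ℚ frac 1 (n₁′ + 1))
                         × ((frac n₂ (n₁′ + 1) -ℚ frac (2 * n₃) n₄ ≡ 1ℚ) ⇔ (q ≡ 3))
                         × (frac n₂ (n₁′ + 1) -ℚ frac (2 * n₄) n₃ ≢ 1ℚ)
    valency-identities refl refl refl refl refl LP≡n₁[P+1] = reciprocal-identity LP≡n₁[P+1] , ratio-3 , ratio-4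

  valency-ratios : ∀ {n₁ n₂ n₃ n₄ q l Q : ℕ} → 2 ≤ q → 2 ≤ Q → l * (q ∸ 1) ≡ Q * q ∸ 1 →
                   n₁ ≡ Q ∸ 1 → n₂ ≡ Q * q ∸ Q → n₃ ≡ (l ∸ 1) * Q → n₄ ≡ (l ∸ 1) * (Q * q ∸ Q) →
                   (frac 1 n₃ +ℚ frac 1 n₄ ≡ frac 1 n₁ -ℚ frac 1 (n₁ + 1))
                   × ((frac n₂ (n₁ + 1) -ℚ frac (2 * n₃) n₄ ≡ 1ℚ) ⇔ (q ≡ 3))
                   × (frac n₂ (n₁ + 1) -ℚ frac (2 * n₄) n₃ ≢ 1ℚ)
  valency-ratios {q = suc (suc p)} {zero}          {suc (suc n)} (s≤s (s≤s _)) (s≤s (s≤s _)) ()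
  valency-ratios {q = suc (suc p)} {suc zero}      {suc (suc n)} (s≤s (s≤s _)) (s≤s (s≤s _)) l[q∸1]≡Qq∸1
    with () ← ℕ.+-cancelˡ-≡ p 0 _ (ℕ.suc-injective l[q∸1]≡Qq∸1)
  valency-ratios {q = suc (suc p)} {suc (suc m)}  {suc (suc n)} (s≤s (s≤s _)) (s≤s (s≤s _)) l[q∸1]≡Qq∸1 n₁≡ n₂≡ n₃≡ n₄≡ =
    valency-identities n₁≡ (trans n₂≡ Qq∸Q≡QP) n₃≡ (trans n₄≡ (cong (suc m *_) Qq∸Q≡QP)) refl
      (ℕ.+-cancelˡ-≡ (suc p) _ _ l[q∸1]≡Qq∸1)
    where
    open Ratios n p m
    Qq∸Q≡QP : Q * suc P ∸ Q ≡ Q * P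
    Qq∸Q≡QP = trans (cong (_∸ Q) (ℕ.*-suc Q P)) (ℕ.m+n∸m≡n Q (Q * P))

open FractionArithmetic using (valency-ratios)

open import Data.Nat using (ℕ; _≤_; _^_; _∸_; _+_; _*_; NonZero)
open import Function.Bundles using (_⇔_)
open import Relation.Binary.PropositionalEquality using (_≡_; _≢_)

prime-power⇒2≤ : ∀ {q} → IsPrimePower q → 2 ≤ q
prime-power⇒2≤ (p , suc k , p-prime , _ , refl) = ℕ.≤-trans (ℕ.nonTrivial⇒n>1 p) (ℕ.m≤m*n p (p ^ k))
  where
  instance
    _ = prime⇒nonTrivial p-prime
    _ = ℕ.m^n≢0 p k {{ℕ.nonTrivial⇒nonZero p}}

lemma4p2 : (F : FiniteField) (q r : ℕ) → IsPrimePower q → 2 ≤ r →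
  FiniteField.size F ≡ q ^ r →
  (σ : FiniteField.Carrier F) → IsGenerator F σ →
  (l : ℕ) {{_ : NonZero l}} → l * (q ∸ 1) ≡ q ^ r ∸ 1 →
  (A : Fin l → FiniteField.Carrier F → Bool) →
  IsOrderingOfMaximalSubgroups F q r l A →
  let open Scheme F q σ l A in
  InverseClosed W →
  let n₁ = card X₁
      n₂ = card X₂
      n₃ = card X₃
      n₄ = card X₄
  in
  (∀ x y x′ y′ → inS X₃ x y ≡ true → inS X₄ x′ y′ ≡ true →
     c X₃ X₃ x y ≡ c X₃ X₃ x′ y′)
  × (frac 1 n₃ +ℚ frac 1 n₄ ≡ frac 1 n₁ -ℚ frac 1 (n₁ + 1))
  × ((frac n₂ (n₁ + 1) -ℚ frac (2 * n₃) n₄ ≡ 1ℚ) ⇔ (q ≡ 3))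
  × (frac n₂ (n₁ + 1) -ℚ frac (2 * n₄) n₃ ≢ 1ℚ)
lemma4p2 F q r q-prime-power r≥2 size≡q^r σ generator l l*[q∸1]≡q^r∸1 A ordering inverse-closed =
  c₃₃-constant inverse-closed , valency-ratios {l = l} q≥2 Q≥2 l*[q∸1]≡Q*q∸1 n₁≡ n₂≡ n₃≡ n₄≡
  where
  q≥2 = prime-power⇒2≤ q-prime-power
  open CayleyScheme F q≥2 r≥2 size≡q^r generator l l*[q∸1]≡q^r∸1 A ordering
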